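{- Let $k\ge 2$, $s\ge 2$, $n\ge 1$ be integers. Let $H$ be the graph with vertex set $\{u_i,v_i:1\le i\le 2k\}\cup\{y_{i,j},z_{i,j}:1\le i\le k,\ 1\le j\le 2n\}$ and edges $u_iv_i$ ($1\le i\le 2k$) and $u_iy_{i,j}$, $v_{2k+1-i}y_{i,j}$, $v_iz_{i,j}$, $u_{2k+1-i}z_{i,j}$ ($1\le i\le k$, $1\le j\le 2n$). Suppose $\{v_1,\dots,v_{2k}\}$ is partitioned into blocks each of size $s$ such that no two vertices in the same block have a common neighbor in $H$, and let $G$ be obtained from $H$ by identifying all vertices of each block into a single vertex. If $G$ is bipartite and every connected component of $G$ has two partite sets of equal size, or $G$ is tripartite (i.e. has chromatic number $3$), then $\chi_{la}(G)=3$.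
   Context: For a graph $G$ with $q$ edges, a local antimagic labeling is a bijection $f:E(G)\to\{1,\dots,q\}$ such that, writing $f^+(u)=\sum_{e\ni u}f(e)$, we have $f^+(u)\ne f^+(v)$ for every edge $uv$. $\chi_{la}(G)$ is the minimum over all local antimagic labelings of the number of distinct values of $f^+$. (The graph $H$ is denoted $G_{k,2}(2n)$ in the paper and the family of such $G$ is $\mathcal J_2(k,2n,s)$.) -}

module Defs where

open import Data.Nat using (ℕ; zero; suc; _+_; _*_; _≤_)
open import Data.Bool using (Bool; true; false; _∨_; _∧_; if_then_else_)
open import Data.Fin using (Fin; toℕ; _↑ˡ_; opposite)
import Data.Fin as F
open import Data.List using (List; []; _∷_; map; _++_; concatMap; allFin; filter; filterᵇ; length; deduplicate)
open import Data.Nat.ListAction using (sum)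
open import Data.Bool.ListAction using (any)
open import Data.Product using (Σ; _×_; _,_; proj₁; proj₂; ∃)
open import Data.Sum using (_⊎_)
open import Relation.Nullary using (¬_; does; yes; no)
open import Relation.Binary.PropositionalEquality using (_≡_; _≢_; refl; cong)
open import Relation.Binary.Definitions using (DecidableEquality)
import Data.Nat as N
open import Function.Bundles using (_⤖_; Bijection)

-- Generic finite (simple) graphs, given by a vertex type with decidable
-- equality, an edge type, the endpoint map, and explicit enumerations of
-- all vertices and all edges (each listed exactly once).

record Graph : Set₁ where
  field
    V        : Set
    E        : Set
    ends     : E → V × V
    _≟V_     : DecidableEquality V
    vertices : List V
    edges    : List E

module _ (G : Graph) where
  open Graph G

  incident : V → E → Bool
  incident x e = does (x ≟V proj₁ (ends e)) ∨ does (x ≟V proj₂ (ends e))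

  Adj : V → V → Set
  Adj x y = Σ E λ e → (ends e ≡ (x , y)) ⊎ (ends e ≡ (y , x))

  size : ℕ
  size = length edges

  -- a labeling: a bijection E → Fin q, label of e is 1 + index, so labels
  -- range over {1,…,q}
  label : (E ⤖ Fin size) → E → ℕ
  label f e = suc (toℕ (Bijection.to f e))

  vsum : (E ⤖ Fin size) → V → ℕ
  vsum f x = sum (map (λ e → if incident x e then label f e else 0) edges)

  IsLocalAntimagic : (E ⤖ Fin size) → Set
  IsLocalAntimagic f = (e : E) → vsum f (proj₁ (ends e)) ≢ vsum f (proj₂ (ends e))

  numColours : (E ⤖ Fin size) → ℕ
  numColours f = length (deduplicate N._≟_ (map (vsum f) vertices))

  LocalAntimagicChromatic≡ : ℕ → Set
  LocalAntimagicChromatic≡ c =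
    (Σ (E ⤖ Fin size) λ f → IsLocalAntimagic f × numColours f ≡ c)
    × ((f : E ⤖ Fin size) → IsLocalAntimagic f → c ≤ numColours f)

  ProperColouring : (m : ℕ) → (V → Fin m) → Set
  ProperColouring m c = (e : E) → c (proj₁ (ends e)) ≢ c (proj₂ (ends e))

  ChromaticNumber3 : Set
  ChromaticNumber3 =
    (Σ (V → Fin 3) (ProperColouring 3)) × ((c : V → Fin 2) → ¬ ProperColouring 2 c)

  reach : ℕ → V → V → Bool
  reach zero x y = does (x ≟V y)
  reach (suc t) x y = reach t x y ∨ any step edges
    where
    step : E → Bool
    step e = (does (x ≟V proj₁ (ends e)) ∧ reach t (proj₂ (ends e)) y)
           ∨ (does (x ≟V proj₂ (ends e)) ∧ reach t (proj₁ (ends e)) y)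

  -- y lies in the connected component of x (walks of length ≤ |V| suffice)
  sameComponent : V → V → Bool
  sameComponent x y = reach (length vertices) x y

  componentColourCount : (V → Fin 2) → V → Fin 2 → ℕ
  componentColourCount c x i =
    length (filterᵇ (λ y → sameComponent x y ∧ does (c y F.≟ i)) vertices)

  BalancedBipartite : Set
  BalancedBipartite =
    Σ (V → Fin 2) λ c → ProperColouring 2 c
      × ((x : V) → componentColourCount c x F.zero ≡ componentColourCount c x (F.suc F.zero))

-- The graph H = G_{k,2}(2n) (0-based indices: Fin (2k) for 1..2k, etc.)
-- opposite i corresponds to 2k+1-i in 1-based indexing.

emb : ∀ {k} → Fin k → Fin (2 * k)
emb {k} i = i ↑ˡ (1 * k)

rev : ∀ {k} → Fin k → Fin (2 * k)
rev {k} i = opposite (emb {k} i)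

data VH (k n : ℕ) : Set where
  u v : Fin (2 * k) → VH k n
  y z : Fin k → Fin (2 * n) → VH k n

-- edge types of H (and of G; identification is a bijection on edges)
data EH (k n : ℕ) : Set where
  uv         : Fin (2 * k) → EH k n
  uy vy vz uz : Fin k → Fin (2 * n) → EH k n

endsH : ∀ {k n} → EH k n → VH k n × VH k n
endsH (uv i)   = u i , v i
endsH {k} (uy i j) = u (emb {k} i) , y i j
endsH {k} (vy i j) = v (rev {k} i) , y i j
endsH {k} (vz i j) = v (emb {k} i) , z i j
endsH {k} (uz i j) = u (rev {k} i) , z i j

AdjH : ∀ {k n} → VH k n → VH k n → Set
AdjH {k} {n} a b = Σ (EH k n) λ e → (endsH e ≡ (a , b)) ⊎ (endsH e ≡ (b , a))

edgesList : (k n : ℕ) → List (EH k n)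
edgesList k n =
  map uv (allFin (2 * k))
  ++ concatMap (λ i → map (uy i) (allFin (2 * n))) (allFin k)
  ++ concatMap (λ i → map (vy i) (allFin (2 * n))) (allFin k)
  ++ concatMap (λ i → map (vz i) (allFin (2 * n))) (allFin k)
  ++ concatMap (λ i → map (uz i) (allFin (2 * n))) (allFin k)

-- Partition of {v_1,…,v_2k} into m blocks, given by b : Fin (2k) → Fin m.

blockSize : ∀ {k m} → (Fin (2 * k) → Fin m) → Fin m → ℕ
blockSize {k} b c = length (filterᵇ (λ i → does (b i F.≟ c)) (allFin (2 * k)))

AllBlocksOfSize : ∀ {k m} → ℕ → (Fin (2 * k) → Fin m) → Set
AllBlocksOfSize {k} {m} s b = (c : Fin m) → blockSize {k} b c ≡ s

NoCommonNeighbour : ∀ {k m} (n : ℕ) → (Fin (2 * k) → Fin m) → Set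
NoCommonNeighbour {k} n b =
  (i j : Fin (2 * k)) → i ≢ j → b i ≡ b j →
  (x : VH k n) → ¬ (AdjH (v i) x × AdjH (v j) x)

-- vertices of G: v's replaced by block vertices w_c
data VG (k n m : ℕ) : Set where
  u : Fin (2 * k) → VG k n m
  w : Fin m → VG k n m
  y z : Fin k → Fin (2 * n) → VG k n m

proj : ∀ {k n m} → (Fin (2 * k) → Fin m) → VH k n → VG k n m
proj b (u i)   = u i
proj b (v i)   = w (b i)
proj b (y i j) = y i j
proj b (z i j) = z i j

_≟G_ : ∀ {k n m} → DecidableEquality (VG k n m)
u i ≟G u j with i F.≟ j
... | yes refl = yes refl
... | no p = no λ { refl → p refl }
w i ≟G w j with i F.≟ j
... | yes refl = yes refl
... | no p = no λ { refl → p refl }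
y i j ≟G y i' j' with i F.≟ i' | j F.≟ j'
... | yes refl | yes refl = yes refl
... | no p | _ = no λ { refl → p refl }
... | _ | no p = no λ { refl → p refl }
z i j ≟G z i' j' with i F.≟ i' | j F.≟ j'
... | yes refl | yes refl = yes refl
... | no p | _ = no λ { refl → p refl }
... | _ | no p = no λ { refl → p refl }
u _ ≟G w _ = no λ ()
u _ ≟G y _ _ = no λ ()
u _ ≟G z _ _ = no λ ()
w _ ≟G u _ = no λ ()
w _ ≟G y _ _ = no λ ()
w _ ≟G z _ _ = no λ ()
y _ _ ≟G u _ = no λ ()
y _ _ ≟G w _ = no λ ()
y _ _ ≟G z _ _ = no λ ()
z _ _ ≟G u _ = no λ ()
z _ _ ≟G w _ = no λ ()
z _ _ ≟G y _ _ = no λ ()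

verticesG : (k n m : ℕ) → List (VG k n m)
verticesG k n m =
  map u (allFin (2 * k))
  ++ map w (allFin m)
  ++ concatMap (λ i → map (y i) (allFin (2 * n))) (allFin k)
  ++ concatMap (λ i → map (z i) (allFin (2 * n))) (allFin k)

Gquot : (k n m : ℕ) → (Fin (2 * k) → Fin m) → Graph
Gquot k n m b = record
  { V        = VG k n m
  ; E        = EH k n
  ; ends     = λ e → proj b (proj₁ (endsH e)) , proj b (proj₂ (endsH e))
  ; _≟V_     = _≟G_
  ; vertices = verticesG k n m
  ; edges    = edgesList k n
  }

module Submission where

-- The lower bound: if a local antimagic labelling had at most two vertex sums a, b,
-- then "sum = a" would be a proper 2-colouring of G, impossible when χ(G) = 3.  When G is
-- bipartite with balanced components, every edge of a component joins an a-vertex to a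
-- b-vertex, so counting the labels at both ends gives a·|A| = b·|B| with |A| = |B| > 0; hence
-- a = b, contradicting local antimagicness at any edge.
-- The upper bound: label the 2k edges u_p v_p with the largest labels and the two edges of each
-- path u_p – y/z – v_{2k+1-p} with complementary labels (summing to q + 1 - 2k), so every y and
-- z gets the same sum.  The complementary pairs are distributed over the 2n paths at each
-- position p so that the sums at all u_p are equal, and then so are the sums at all v_p; each
-- identified vertex gets s times the latter.  These three sums are distinct.

open import Defs
open import Data.Bool using (Bool; true; false; if_then_else_; not; _∨_; _∧_; _xor_; T)
import Data.Bool as Bool
open import Data.Bool.ListAction using (or)
open import Data.Bool.Properties using (∨-identityʳ; ∧-zeroʳ; ∧-identityʳ; not-involutive)
open import Data.Empty using (⊥-elim)
open import Data.Fin using (Fin; zero; suc; toℕ; _↑ˡ_; _↑ʳ_; opposite; splitAt)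
import Data.Fin as F
import Data.Fin.Permutation as Perm
import Data.Fin.Properties as FinP
open import Data.List using (List; []; _∷_; map; _++_; concatMap; allFin; length; tabulate; filter; filterᵇ; deduplicate)
open import Data.List.Membership.Propositional using (_∈_; find)
open import Data.List.Membership.Propositional.Properties
  using (∈-map⁺; ∈-map⁻; ∈-filter⁺; ∈-deduplicate⁺; ∈-deduplicate⁻; ∈-++⁺ˡ; ∈-++⁺ʳ; ∈-concatMap⁺; ∈-allFin)
open import Data.List.Properties using (map-tabulate; map-cong; map-∘; length-filter; filter-notAll)
open import Data.List.Relation.Binary.Subset.Propositional using (_⊆_)
import Data.List.Relation.Unary.All as All
open import Data.List.Relation.Unary.All.Properties using (¬All⇒Any¬)
open import Data.List.Relation.Unary.AllPairs using ([]; _∷_)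
open import Data.List.Relation.Unary.Any using (here; there)
import Data.List.Relation.Unary.Any as Any
open import Data.List.Relation.Unary.Any.Properties using (any⁺; any⁻)
open import Data.List.Relation.Unary.Unique.Propositional using (Unique)
open import Data.List.Relation.Unary.Unique.DecPropositional.Properties using (deduplicate-!)
open import Data.Nat using (ℕ; zero; suc; _+_; _*_; _∸_; _≤_; _<_; z≤n; s≤s; _<ᵇ_; _≡ᵇ_; _<?_)
import Data.Nat as ℕ
open import Data.Nat.DivMod using (_%_; _/_; [m+kn]%n≡m%n; m<n⇒m%n≡m; m*n%n≡0; +-distrib-/-∣ʳ; m<n⇒m/n≡0; m*n/n≡m)
open import Data.Nat.Divisibility using (divides-refl)
open import Data.Nat.ListAction using (sum)
open import Data.Nat.Properties
open import Algebra.Properties.CommutativeSemigroup +-commutativeSemigroup using (interchange)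
open import Algebra.Properties.Semiring.Sum +-*-semiring
  using (sum-syntax; sum-cong-≗; ∑-distrib-+; sum-permute)
  renaming (sum to ∑)
open import Data.Nat.Tactic.RingSolver using (solve-∀)
open import Data.Product using (Σ; ∃; ∃₂; _×_; _,_; proj₁; proj₂)
open import Data.Product.Function.NonDependent.Propositional using (_×-↔_)
open import Data.Sum using (_⊎_; inj₁; inj₂; [_,_]′)
open import Data.Sum.Function.Propositional using (_⊎-↔_)
open import Function using (_∘_; _⤖_; _↔_; mk↔ₛ′; mk⤖; Inverse; Injection)
open import Function.Definitions using (Injective)
open import Function.Properties.Inverse using (↔-refl; ↔-sym; ↔-trans; ↔⇒↣)
open import Relation.Binary.Definitions using (DecidableEquality)
open import Relation.Binary.PropositionalEquality
open import Relation.Nullary using (¬_; Dec; yes; no; does; ¬?)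
open import Relation.Nullary.Decidable using (T?)

private
  variable
    A : Set

-- Finite sums

∑-const : ∀ m c → ∑[ i < m ] c ≡ m * c
∑-const zero    c = refl
∑-const (suc m) c = cong (c +_) (∑-const m c)

∑-zero : ∀ m → ∑[ i < m ] 0 ≡ 0
∑-zero m = trans (∑-const m 0) (*-zeroʳ m)

∑-if : ∀ m (b : Bool) (f : Fin m → ℕ) →
       ∑[ i < m ] (if b then f i else 0) ≡ (if b then ∑[ i < m ] f i else 0)
∑-if m true  f = refl
∑-if m false f = ∑-zero m

∑-δ : ∀ {m} (p : Fin m) (f : Fin m → ℕ) → ∑[ q < m ] (if does (p F.≟ q) then f q else 0) ≡ f p
∑-δ {suc m} zero    f = trans (cong (f zero +_) (∑-zero m)) (+-identityʳ _)
∑-δ         (suc p) f = trans (sum-cong-≗ step) (∑-δ p (f ∘ suc))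
  where
  step : ∀ q → (if does (suc p F.≟ suc q) then f (suc q) else 0) ≡ (if does (p F.≟ q) then f (suc q) else 0)
  step q with p F.≟ q
  ... | yes _ = refl
  ... | no  _ = refl

∑-↑ : ∀ m n (f : Fin (m + n) → ℕ) → ∑[ q < m + n ] f q ≡ ∑[ i < m ] f (i ↑ˡ n) + ∑[ i < n ] f (m ↑ʳ i)
∑-↑ zero    n f = refl
∑-↑ (suc m) n f = trans (cong (f zero +_) (∑-↑ m n (f ∘ suc))) (sym (+-assoc (f zero) _ _))

∑-opposite : ∀ n (f : Fin n → ℕ) → ∑[ i < n ] f (opposite i) ≡ ∑[ i < n ] f i
∑-opposite n f = sym (sum-permute f Perm.reverse)

sum-allFin : ∀ m (f : Fin m → ℕ) → sum (map f (allFin m)) ≡ ∑[ i < m ] f i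
sum-allFin m f = trans (cong sum (map-tabulate (λ i → i) f)) (sum-tabulate m f)
  where
  sum-tabulate : ∀ m (f : Fin m → ℕ) → sum (tabulate f) ≡ ∑[ i < m ] f i
  sum-tabulate zero    f = refl
  sum-tabulate (suc m) f = cong (f zero +_) (sum-tabulate m (f ∘ suc))

opposite-↑ˡ : ∀ {m} (i : Fin m) → opposite (i ↑ˡ m) ≡ m ↑ʳ opposite i
opposite-↑ˡ {m} i = FinP.toℕ-injective (begin
  toℕ (opposite (i ↑ˡ m))    ≡⟨ FinP.opposite-prop (i ↑ˡ m) ⟩
  m + m ∸ suc (toℕ (i ↑ˡ m)) ≡⟨ cong (λ t → m + m ∸ suc t) (FinP.toℕ-↑ˡ i m) ⟩
  m + m ∸ suc (toℕ i)        ≡⟨ +-∸-assoc m (FinP.toℕ<n i) ⟩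
  m + (m ∸ suc (toℕ i))      ≡⟨ cong (m +_) (FinP.opposite-prop i) ⟨
  m + toℕ (opposite i)       ≡⟨ FinP.toℕ-↑ʳ m (opposite i) ⟨
  toℕ (m ↑ʳ opposite i)      ∎)
  where open ≡-Reasoning

∑-↑ˡ+opposite : ∀ m n → m ≡ n → (f : Fin (m + n) → ℕ) →
                ∑[ i < m ] f (i ↑ˡ n) + ∑[ i < m ] f (opposite (i ↑ˡ n)) ≡ ∑[ q < m + n ] f q
∑-↑ˡ+opposite m .m refl f = begin
  ∑[ i < m ] f (i ↑ˡ m) + ∑[ i < m ] f (opposite (i ↑ˡ m))
    ≡⟨ cong (∑[ i < m ] f (i ↑ˡ m) +_) (sum-cong-≗ {m} (cong f ∘ opposite-↑ˡ)) ⟩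
  ∑[ i < m ] f (i ↑ˡ m) + ∑[ i < m ] f (m ↑ʳ opposite i)
    ≡⟨ cong (∑[ i < m ] f (i ↑ˡ m) +_) (∑-opposite m (f ∘ (m ↑ʳ_))) ⟩
  ∑[ i < m ] f (i ↑ˡ m) + ∑[ i < m ] f (m ↑ʳ i)
    ≡⟨ ∑-↑ m m f ⟨
  ∑[ q < m + m ] f q
    ∎
  where open ≡-Reasoning

sum-map-cong : ∀ (xs : List A) {f g : A → ℕ} → (∀ x → f x ≡ g x) → sum (map f xs) ≡ sum (map g xs)
sum-map-cong []       eq = refl
sum-map-cong (x ∷ xs) eq = cong₂ _+_ (eq x) (sum-map-cong xs eq)

sum-map-++ : ∀ (f : A → ℕ) xs ys → sum (map f (xs ++ ys)) ≡ sum (map f xs) + sum (map f ys)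
sum-map-++ f []       ys = refl
sum-map-++ f (x ∷ xs) ys = trans (cong (f x +_) (sum-map-++ f xs ys)) (sym (+-assoc (f x) _ _))

sum-map-+ : ∀ (f g : A → ℕ) xs → sum (map (λ x → f x + g x) xs) ≡ sum (map f xs) + sum (map g xs)
sum-map-+ f g []       = refl
sum-map-+ f g (x ∷ xs) = trans (cong (f x + g x +_) (sum-map-+ f g xs)) (interchange (f x) (g x) _ _)

sum-map-zero : ∀ (xs : List A) → sum (map (λ _ → 0) xs) ≡ 0
sum-map-zero []       = refl
sum-map-zero (x ∷ xs) = sum-map-zero xs

sum-map-*ˡ : ∀ c (f : A → ℕ) xs → sum (map (λ x → c * f x) xs) ≡ c * sum (map f xs)
sum-map-*ˡ c f []       = sym (*-zeroʳ c)
sum-map-*ˡ c f (x ∷ xs) = trans (cong (c * f x +_) (sum-map-*ˡ c f xs)) (sym (*-distribˡ-+ c (f x) _))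

sum-map-swap : ∀ {B : Set} (xs : List A) (ys : List B) (f : A → B → ℕ) →
               sum (map (λ x → sum (map (f x) ys)) xs) ≡ sum (map (λ x′ → sum (map (λ x → f x x′) xs)) ys)
sum-map-swap []       ys f = sym (sum-map-zero ys)
sum-map-swap (x ∷ xs) ys f =
  trans (cong (sum (map (f x) ys) +_) (sum-map-swap xs ys f)) (sym (sum-map-+ (f x) _ ys))

sum-concatMap-allFin : ∀ {B : Set} a c (g : Fin a → Fin c → B) (f : B → ℕ) →
  sum (map f (concatMap (λ i → map (g i) (allFin c)) (allFin a))) ≡ ∑[ i < a ] ∑[ j < c ] f (g i j)
sum-concatMap-allFin a c g f = trans (sum-concat (allFin a)) (sum-allFin a _)
  where
  sum-concat : ∀ is → sum (map f (concatMap (λ i → map (g i) (allFin c)) is))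
                      ≡ sum (map (λ i → ∑[ j < c ] f (g i j)) is)
  sum-concat []       = refl
  sum-concat (i ∷ is) =
    trans (sum-map-++ f (map (g i) (allFin c)) _)
          (cong₂ _+_ (trans (cong sum (sym (map-∘ (allFin c)))) (sum-allFin c _)) (sum-concat is))

length≡sum-map-1 : ∀ (xs : List A) → length xs ≡ sum (map (λ _ → 1) xs)
length≡sum-map-1 []       = refl
length≡sum-map-1 (x ∷ xs) = cong suc (length≡sum-map-1 xs)

length-filterᵇ-mono : ∀ (P Q : A → Bool) xs → (∀ x → T (P x) → T (Q x)) →
                      length (filterᵇ P xs) ≤ length (filterᵇ Q xs)
length-filterᵇ-mono P Q []       P⇒Q = z≤n
length-filterᵇ-mono P Q (x ∷ xs) P⇒Q with P x in px | Q x in qx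
... | true  | true  = s≤s (length-filterᵇ-mono P Q xs P⇒Q)
... | true  | false = ⊥-elim (subst T qx (P⇒Q x (subst T (sym px) _)))
... | false | true  = m≤n⇒m≤1+n (length-filterᵇ-mono P Q xs P⇒Q)
... | false | false = length-filterᵇ-mono P Q xs P⇒Q

length-filterᵇ-strict : ∀ (P Q : A → Bool) xs → (∀ x → T (P x) → T (Q x)) →
                        ∀ {x} → x ∈ xs → T (Q x) → ¬ T (P x) →
                        suc (length (filterᵇ P xs)) ≤ length (filterᵇ Q xs)
length-filterᵇ-strict P Q (x ∷ xs) P⇒Q (here refl) qx ¬px with P x | Q x
length-filterᵇ-strict P Q (x ∷ xs) P⇒Q (here refl) qx ¬px | true  | _    = ⊥-elim (¬px _)
length-filterᵇ-strict P Q (x ∷ xs) P⇒Q (here refl) qx ¬px | false | true = s≤s (length-filterᵇ-mono P Q xs P⇒Q)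
length-filterᵇ-strict P Q (x′ ∷ xs) P⇒Q (there x∈) qx ¬px with P x′ in px′ | Q x′ in qx′
... | true  | true  = s≤s (length-filterᵇ-strict P Q xs P⇒Q x∈ qx ¬px)
... | true  | false = ⊥-elim (subst T qx′ (P⇒Q x′ (subst T (sym px′) _)))
... | false | true  = m≤n⇒m≤1+n (length-filterᵇ-strict P Q xs P⇒Q x∈ qx ¬px)
... | false | false = length-filterᵇ-strict P Q xs P⇒Q x∈ qx ¬px

∈-from-occurrences : ∀ (_≟_ : DecidableEquality A) {x} xs →
                     1 ≤ sum (map (λ x′ → if does (x′ ≟ x) then 1 else 0) xs) → x ∈ xs
∈-from-occurrences _≟_ {x} (x′ ∷ xs) occurs with x′ ≟ x
... | yes refl = here refl
... | no  _    = there (∈-from-occurrences _≟_ xs occurs)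

∈-family : ∀ {B : Set} {a c} (g : Fin a → Fin c → B) i j → g i j ∈ concatMap (λ i′ → map (g i′) (allFin c)) (allFin a)
∈-family g i j =
  ∈-concatMap⁺ (λ i′ → map (g i′) (allFin _)) (Any.map (λ { refl → ∈-map⁺ (g i) (∈-allFin j) }) (∈-allFin i))

length-filterᵇ-cong : ∀ (P Q : A → Bool) xs → (∀ x → P x ≡ Q x) → length (filterᵇ P xs) ≡ length (filterᵇ Q xs)
length-filterᵇ-cong P Q []       P≡Q = refl
length-filterᵇ-cong P Q (x ∷ xs) P≡Q with P x | Q x | P≡Q x
... | true  | .true  | refl = cong suc (length-filterᵇ-cong P Q xs P≡Q)
... | false | .false | refl = length-filterᵇ-cong P Q xs P≡Q

length-filterᵇ-nonempty : ∀ (P : A → Bool) xs {x} → x ∈ xs → T (P x) → 1 ≤ length (filterᵇ P xs)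
length-filterᵇ-nonempty P (x ∷ xs) (here refl) px with P x
... | true = s≤s z≤n
length-filterᵇ-nonempty P (x′ ∷ xs) (there x∈) px with P x′
... | true  = s≤s z≤n
... | false = length-filterᵇ-nonempty P xs x∈ px

Bool-ext : ∀ {p q : Bool} → (T p → T q) → (T q → T p) → p ≡ q
Bool-ext {false} {false} _ _ = refl
Bool-ext {false} {true}  _ g = ⊥-elim (g _)
Bool-ext {true}  {false} f _ = ⊥-elim (f _)
Bool-ext {true}  {true}  _ _ = refl

T-∨⁺ˡ : ∀ {p} q → T p → T (p ∨ q)
T-∨⁺ˡ {true} q _ = _

T-∨⁺ʳ : ∀ p {q} → T q → T (p ∨ q)
T-∨⁺ʳ true  _  = _
T-∨⁺ʳ false tq = tq

T-∨⁻ : ∀ p {q} → T (p ∨ q) → T p ⊎ T q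
T-∨⁻ true  _  = inj₁ _
T-∨⁻ false tq = inj₂ tq

T-∧⁺ : ∀ {p q} → T p → T q → T (p ∧ q)
T-∧⁺ {true} _ tq = tq

T-∧⁻ : ∀ p {q} → T (p ∧ q) → T p × T q
T-∧⁻ true tq = _ , tq

Bool-strict : ∀ {p q} → (T p → T q) → p ≢ q → T q × ¬ T p
Bool-strict {false} {false} _   p≢q = ⊥-elim (p≢q refl)
Bool-strict {false} {true}  _   _   = _ , λ ()
Bool-strict {true}  {false} p⇒q _   = ⊥-elim (p⇒q _)
Bool-strict {true}  {true}  _   p≢q = ⊥-elim (p≢q refl)

∧-congʳ-under : ∀ p {q q′} → (T p → q ≡ q′) → p ∧ q ≡ p ∧ q′
∧-congʳ-under true  q≡q′ = q≡q′ _
∧-congʳ-under false _    = refl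

T⇒≡ : ∀ {p} → T p → p ≡ true
T⇒≡ {true} _ = refl

T-not⇒≡ : ∀ {p} → T (not p) → p ≡ false
T-not⇒≡ {false} _ = refl

T-does⁺ : ∀ {P : Set} (d : Dec P) → P → T (does d)
T-does⁺ (yes _) _ = _
T-does⁺ (no ¬p) p = ¬p p

T-does⁻ : ∀ {P : Set} (d : Dec P) → T (does d) → P
T-does⁻ (yes p) _ = p

indicator : Bool → ℕ
indicator p = if p then 1 else 0

if≡*indicator : ∀ p k → (if p then k else 0) ≡ k * indicator p
if≡*indicator true  k = sym (*-identityʳ k)
if≡*indicator false k = sym (*-zeroʳ k)

sum-if-const : ∀ (P : A → Bool) (g : A → ℕ) c xs → (∀ x → T (P x) → g x ≡ c) →
               sum (map (λ x → if P x then g x else 0) xs) ≡ c * length (filterᵇ P xs)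
sum-if-const P g c []       _  = sym (*-zeroʳ c)
sum-if-const P g c (x ∷ xs) on with P x in px
... | true  = trans (cong₂ _+_ (on x (subst T (sym px) _)) (sum-if-const P g c xs on)) (sym (*-suc c _))
... | false = sum-if-const P g c xs on

does-sym : ∀ {m} (p q : Fin m) → does (p F.≟ q) ≡ does (q F.≟ p)
does-sym p q with p F.≟ q | q F.≟ p
... | yes _   | yes _   = refl
... | no  _   | no  _   = refl
... | yes p≡q | no  q≢p = ⊥-elim (q≢p (sym p≡q))
... | no  p≢q | yes q≡p = ⊥-elim (p≢q (sym q≡p))

<ᵇ-true : ∀ {m n} → m < n → (m <ᵇ n) ≡ true
<ᵇ-true lt = T⇒≡ (<⇒<ᵇ lt)

<ᵇ-false : ∀ {m n} → n ≤ m → (m <ᵇ n) ≡ false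
<ᵇ-false {m} {n} ge with m <ᵇ n in eq
... | false = refl
... | true  = ⊥-elim (<⇒≱ (<ᵇ⇒< m n (subst T (sym eq) _)) ge)

module _ {A : Set} (_≟_ : DecidableEquality A) where

  Unique⇒length≤ : ∀ {xs ys : List A} → Unique xs → xs ⊆ ys → length xs ≤ length ys
  Unique⇒length≤ {[]}     _              _  = z≤n
  Unique⇒length≤ {x ∷ xs} {ys} (x∉xs ∷ !xs) xs⊆ys = ≤-trans (s≤s (Unique⇒length≤ !xs xs⊆ys-x))
    (filter-notAll (¬? ∘ (x ≟_)) ys (Any.map (λ x≡ x≢ → x≢ x≡) (xs⊆ys (here refl))))
    where
    xs⊆ys-x : xs ⊆ filter (¬? ∘ (x ≟_)) ys
    xs⊆ys-x t∈ = ∈-filter⁺ (¬? ∘ (x ≟_)) (xs⊆ys (there t∈)) (All.lookup x∉xs t∈)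

  length-deduplicate≡3 : ∀ xs {a b c} → a ≢ b → a ≢ c → b ≢ c →
    (∀ {t} → t ∈ xs → t ≡ a ⊎ t ≡ b ⊎ t ≡ c) → a ∈ xs → b ∈ xs → c ∈ xs →
    length (deduplicate _≟_ xs) ≡ 3
  length-deduplicate≡3 xs {a} {b} {c} a≢b a≢c b≢c only-abc a∈ b∈ c∈ = ≤-antisym
    (Unique⇒length≤ (deduplicate-! _≟_ xs) (λ t∈ → ∈abc (only-abc (∈-deduplicate⁻ _≟_ xs t∈))))
    (Unique⇒length≤ ((a≢b All.∷ a≢c All.∷ All.[]) ∷ (b≢c All.∷ All.[]) ∷ All.[] ∷ []) abc⊆)
    where
    ∈abc : ∀ {t} → t ≡ a ⊎ t ≡ b ⊎ t ≡ c → t ∈ a ∷ b ∷ c ∷ []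
    ∈abc (inj₁ t≡a)        = here t≡a
    ∈abc (inj₂ (inj₁ t≡b)) = there (here t≡b)
    ∈abc (inj₂ (inj₂ t≡c)) = there (there (here t≡c))
    abc⊆ : a ∷ b ∷ c ∷ [] ⊆ deduplicate _≟_ xs
    abc⊆ (here refl)                 = ∈-deduplicate⁺ _≟_ a∈
    abc⊆ (there (here refl))         = ∈-deduplicate⁺ _≟_ b∈
    abc⊆ (there (there (here refl))) = ∈-deduplicate⁺ _≟_ c∈

  length-deduplicate≤2 : ∀ {t₀} xs → t₀ ∈ xs → length (deduplicate _≟_ xs) ≤ 2 →
                         ∃₂ λ a b → ∀ {t} → t ∈ xs → t ≡ a ⊎ t ≡ b
  length-deduplicate≤2 xs t₀∈ short = two-values (deduplicate _≟_ xs) short (∈-deduplicate⁺ _≟_)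
    where
    two-values : ∀ ds → length ds ≤ 2 → xs ⊆ ds → ∃₂ λ a b → ∀ {t} → t ∈ xs → t ≡ a ⊎ t ≡ b
    two-values []           _ xs⊆ds with () ← xs⊆ds t₀∈
    two-values (a ∷ [])     _ xs⊆ds = a , a , λ t∈ → inj₁ (one (xs⊆ds t∈))
      where
      one : ∀ {t} → t ∈ a ∷ [] → t ≡ a
      one (here t≡a) = t≡a
    two-values (a ∷ b ∷ []) _ xs⊆ds = a , b , λ t∈ → two (xs⊆ds t∈)
      where
      two : ∀ {t} → t ∈ a ∷ b ∷ [] → t ≡ a ⊎ t ≡ b
      two (here t≡a)         = inj₁ t≡a
      two (there (here t≡b)) = inj₂ t≡b
    two-values (_ ∷ _ ∷ _ ∷ _) (s≤s (s≤s ())) _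

↑ˡ-or-opposite : ∀ m n → m ≡ n → (p : Fin (m + n)) → (∃ λ i → i ↑ˡ n ≡ p) ⊎ (∃ λ i → opposite (i ↑ˡ n) ≡ p)
↑ˡ-or-opposite m .m refl p with splitAt m p in eq
... | inj₁ i = inj₁ (i , FinP.splitAt⁻¹-↑ˡ eq)
... | inj₂ i = inj₂ (opposite i , trans (opposite-↑ˡ (opposite i))
                                        (trans (cong (m ↑ʳ_) (FinP.opposite-involutive i)) (FinP.splitAt⁻¹-↑ʳ eq)))

↑ˡ≢opposite-↑ˡ : ∀ m n → m ≡ n → (i j : Fin m) → i ↑ˡ n ≢ opposite (j ↑ˡ n)
↑ˡ≢opposite-↑ˡ m .m refl i j eq with () ← trans (sym (FinP.splitAt-↑ˡ m i m))
                                              (trans (cong (splitAt m) (trans eq (opposite-↑ˡ j))) (FinP.splitAt-↑ʳ m m (opposite j)))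

injective⇒surjective : ∀ {n} (f : Fin n → Fin n) → Injective _≡_ _≡_ f → ∀ t → ∃ λ x → f x ≡ t
injective⇒surjective {suc n} f f-inj t with FinP.any? (λ x → f x F.≟ t)
... | yes hit = hit
... | no miss = ⊥-elim (<-irrefl refl (FinP.injective⇒≤ g-inj))
  where
  g : Fin (suc n) → Fin n
  g x = F.punchOut {i = t} {j = f x} (λ t≡fx → miss (x , sym t≡fx))
  g-inj : Injective _≡_ _≡_ g
  g-inj {x} {x′} eq = f-inj (FinP.punchOut-injective (λ t≡fx → miss (x , sym t≡fx)) (λ t≡fx → miss (x′ , sym t≡fx)) eq)

injection⇒bijection : ∀ {n} → A ↔ Fin n → (f : A → Fin n) → Injective _≡_ _≡_ f → A ⤖ Fin n
injection⇒bijection A↔Fin f f-inj = mk⤖ (f-inj , surjective)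
  where
  open Inverse A↔Fin using (from)
  surjective : ∀ t → ∃ λ a → ∀ {a′} → a′ ≡ a → f a′ ≡ t
  surjective t with injective⇒surjective (f ∘ from) (Injection.injective (↔⇒↣ (↔-sym A↔Fin)) ∘ f-inj) t
  ... | x , fx≡t = from x , λ { refl → fx≡t }

-- Graphs

module _ (G : Graph) where
  open Graph G

  end₁ end₂ : E → V
  end₁ = proj₁ ∘ ends
  end₂ = proj₂ ∘ ends

  Joins : E → V → V → Set
  Joins e x x′ = (end₁ e ≡ x × end₂ e ≡ x′) ⊎ (end₂ e ≡ x × end₁ e ≡ x′)

  weightSum : (E → ℕ) → V → ℕ
  weightSum L x = sum (map (λ e → if incident G x e then L e else 0) edges)

  occurrences : V → ℕ
  occurrences x = sum (map (λ x′ → if does (x′ ≟V x) then 1 else 0) vertices)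

module Components (G : Graph)
  (vertices-complete : ∀ x → x ∈ Graph.vertices G)
  (edges-complete : ∀ e → e ∈ Graph.edges G) where
  open Graph G

  stepᵇ : ℕ → V → V → E → Bool
  stepᵇ t x x′ e = (does (x ≟V end₁ G e) ∧ reach G t (end₂ G e) x′)
                 ∨ (does (x ≟V end₂ G e) ∧ reach G t (end₁ G e) x′)

  reach-weaken : ∀ {t x x′} → T (reach G t x x′) → T (reach G (suc t) x x′)
  reach-weaken r = T-∨⁺ˡ _ r

  step-joins : ∀ {t e x x₁ x′} → Joins G e x x₁ → T (reach G t x₁ x′) → T (stepᵇ t x x′ e)
  step-joins {t} {e} {x′ = x′} (inj₁ (refl , refl)) r =
    T-∨⁺ˡ {does (end₁ G e ≟V end₁ G e) ∧ reach G t (end₂ G e) x′} _ (T-∧⁺ (T-does⁺ (_ ≟V _) refl) r)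
  step-joins {t} {e} {x′ = x′} (inj₂ (refl , refl)) r =
    T-∨⁺ʳ (does (end₂ G e ≟V end₁ G e) ∧ reach G t (end₂ G e) x′) (T-∧⁺ (T-does⁺ (_ ≟V _) refl) r)

  reach-cons : ∀ {t e x x₁ x′} → Joins G e x x₁ → T (reach G t x₁ x′) → T (reach G (suc t) x x′)
  reach-cons {t} {e} {x} {x₁} {x′} j r =
    T-∨⁺ʳ (reach G t x x′)
          (any⁺ (stepᵇ t x x′) (Any.map (λ { refl → step-joins {t} {e} {x} {x₁} {x′} j r }) (edges-complete e)))

  reach-suc⁻ : ∀ {t x x′} → T (reach G (suc t) x x′) →
               T (reach G t x x′) ⊎ ∃₂ λ e x₁ → Joins G e x x₁ × T (reach G t x₁ x′)
  reach-suc⁻ {t} {x} {x′} r with T-∨⁻ (reach G t x x′) r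
  ... | inj₁ r′ = inj₁ r′
  ... | inj₂ s with Any.satisfied (any⁻ (stepᵇ t x x′) edges s)
  ... | e , st with T-∨⁻ (does (x ≟V end₁ G e) ∧ reach G t (end₂ G e) x′) st
  ... | inj₁ st₁ = let (eq , r′) = T-∧⁻ (does (x ≟V end₁ G e)) st₁
                   in inj₂ (e , end₂ G e , inj₁ (sym (T-does⁻ (x ≟V end₁ G e) eq) , refl) , r′)
  ... | inj₂ st₂ = let (eq , r′) = T-∧⁻ (does (x ≟V end₂ G e)) st₂
                   in inj₂ (e , end₁ G e , inj₂ (sym (T-does⁻ (x ≟V end₂ G e) eq) , refl) , r′)

  reach-refl : ∀ t x → T (reach G t x x)
  reach-refl zero    x = T-does⁺ (x ≟V x) refl
  reach-refl (suc t) x = reach-weaken {t} {x} {x} (reach-refl t x)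

  reach-snoc : ∀ t {e x x₁ x′} → Joins G e x₁ x′ → T (reach G t x x₁) → T (reach G (suc t) x x′)
  reach-snoc zero {e} {x} {x₁} {x′} j r with T-does⁻ (x ≟V x₁) r
  ... | refl = reach-cons {0} {e} {x} {x′} {x′} j (reach-refl 0 x′)
  reach-snoc (suc t) {e} {x} {x₁} {x′} j r with reach-suc⁻ {t} {x} {x₁} r
  ... | inj₁ r′                   = reach-weaken {suc t} {x} {x′} (reach-snoc t j r′)
  ... | inj₂ (e′ , x₂ , j′ , r′) = reach-cons {suc t} {e′} {x} {x₂} {x′} j′ (reach-snoc t j r′)

  reach-invariant : (π : V → A) → (∀ e → π (end₁ G e) ≡ π (end₂ G e)) →
                    ∀ t {x x′} → T (reach G t x x′) → π x ≡ π x′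
  reach-invariant π inv zero    {x} {x′} r = cong π (T-does⁻ (x ≟V x′) r)
  reach-invariant π inv (suc t) {x} {x′} r with reach-suc⁻ {t} {x} {x′} r
  ... | inj₁ r′                  = reach-invariant π inv t r′
  ... | inj₂ (e , _ , j , r′) = trans (joined j) (reach-invariant π inv t r′)
    where
    joined : ∀ {x x₁} → Joins G e x x₁ → π x ≡ π x₁
    joined (inj₁ (refl , refl)) = inv e
    joined (inj₂ (refl , refl)) = sym (inv e)

  reachCount : ℕ → V → ℕ
  reachCount t x′ = length (filterᵇ (λ x → reach G t x x′) vertices)

  reach-stable-step : ∀ t x′ → (∀ x → reach G (suc t) x x′ ≡ reach G t x x′) →
                      ∀ x → reach G (suc (suc t)) x x′ ≡ reach G (suc t) x x′
  reach-stable-step t x′ h x =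
    cong₂ _∨_ (h x) (cong or (map-cong (λ e → cong₂ _∨_ (cong (does (x ≟V end₁ G e) ∧_) (h (end₂ G e)))
                                                      (cong (does (x ≟V end₂ G e) ∧_) (h (end₁ G e)))) edges))

  reach-grows : ∀ t x′ → (∀ x → reach G (suc t) x x′ ≡ reach G t x x′)
                         ⊎ (suc (reachCount t x′) ≤ reachCount (suc t) x′)
  reach-grows t x′ with All.all? (λ x → reach G (suc t) x x′ Bool.≟ reach G t x x′) vertices
  ... | yes same = inj₁ λ x → All.lookup same (vertices-complete x)
  ... | no ¬same with find (¬All⇒Any¬ (λ x → reach G (suc t) x x′ Bool.≟ reach G t x x′) vertices ¬same)
  ... | x , x∈ , differ =
    let (new , ¬old) = Bool-strict (reach-weaken {t} {x} {x′}) (differ ∘ sym)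
    in inj₂ (length-filterᵇ-strict _ _ vertices (λ x → reach-weaken {t} {x} {x′}) x∈ new ¬old)

  reach-stabilises : ∀ t x′ → (∀ x → reach G (suc t) x x′ ≡ reach G t x x′) ⊎ (2 + t ≤ reachCount (suc t) x′)
  reach-stabilises zero x′ with reach-grows 0 x′
  ... | inj₁ same  = inj₁ same
  ... | inj₂ grows = inj₂ (≤-trans (s≤s (length-filterᵇ-nonempty _ vertices (vertices-complete x′) (reach-refl 0 x′))) grows)
  reach-stabilises (suc t) x′ with reach-stabilises t x′
  ... | inj₁ same = inj₁ (reach-stable-step t x′ same)
  ... | inj₂ big with reach-grows (suc t) x′
  ...   | inj₁ same  = inj₁ same
  ...   | inj₂ grows = inj₂ (≤-trans (s≤s big) grows)

  -- Reachability in t steps grows strictly until it stabilises, so it is stable after |V| steps.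
  reach-stable : ∀ x x′ → reach G (suc (length vertices)) x x′ ≡ reach G (length vertices) x x′
  reach-stable x x′ with reach-stabilises (length vertices) x′
  ... | inj₁ same = same x
  ... | inj₂ big  = ⊥-elim (<-irrefl refl (≤-trans (n≤1+n _) (≤-trans big
                                   (length-filter (T? ∘ λ x → reach G (suc (length vertices)) x x′) vertices))))

  sameComponent-edge : ∀ x e → sameComponent G x (end₁ G e) ≡ sameComponent G x (end₂ G e)
  sameComponent-edge x e = Bool-ext
    (λ r → subst T (reach-stable x (end₂ G e)) (reach-snoc (length vertices) {e} {x} (inj₁ (refl , refl)) r))
    (λ r → subst T (reach-stable x (end₁ G e)) (reach-snoc (length vertices) {e} {x} (inj₂ (refl , refl)) r))

module DoubleCounting (G : Graph) (vertices-once : ∀ x → occurrences G x ≡ 1) where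
  open Graph G

  sum-at : ∀ x₀ k → sum (map (λ x → if does (x ≟V x₀) then k else 0) vertices) ≡ k
  sum-at x₀ k = begin
    sum (map (λ x → if does (x ≟V x₀) then k else 0) vertices)  ≡⟨ sum-map-cong vertices (λ x → if≡*indicator _ k) ⟩
    sum (map (λ x → k * indicator (does (x ≟V x₀))) vertices)   ≡⟨ sum-map-*ˡ k _ vertices ⟩
    k * sum (map (λ x → indicator (does (x ≟V x₀))) vertices)   ≡⟨ cong (k *_) (vertices-once x₀) ⟩
    k * 1                                                      ≡⟨ *-identityʳ k ⟩
    k                                                          ∎
    where open ≡-Reasoning

  incidence-count : ∀ (P : V → Bool) e → end₁ G e ≢ end₂ G e →
    sum (map (λ x → indicator (P x ∧ incident G x e)) vertices) ≡ indicator (P (end₁ G e)) + indicator (P (end₂ G e))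
  incidence-count P e loopless = trans (sum-map-cong vertices split) (trans (sum-map-+ _ _ vertices)
    (cong₂ _+_ (sum-at (end₁ G e) _) (sum-at (end₂ G e) _)))
    where
    split : ∀ x → indicator (P x ∧ incident G x e)
                ≡ (if does (x ≟V end₁ G e) then indicator (P (end₁ G e)) else 0)
                  + (if does (x ≟V end₂ G e) then indicator (P (end₂ G e)) else 0)
    split x with x ≟V end₁ G e | x ≟V end₂ G e
    ... | yes refl | yes x≡e₂ = ⊥-elim (loopless x≡e₂)
    ... | yes refl | no _     = trans (cong indicator (∧-identityʳ _)) (sym (+-identityʳ _))
    ... | no _     | yes refl = cong indicator (∧-identityʳ _)
    ... | no _     | no _     = cong indicator (∧-zeroʳ _)

  double-count : ∀ (L : E → ℕ) (P : V → Bool) → (∀ e → end₁ G e ≢ end₂ G e) →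
    sum (map (λ x → if P x then weightSum G L x else 0) vertices)
      ≡ sum (map (λ e → L e * (indicator (P (end₁ G e)) + indicator (P (end₂ G e)))) edges)
  double-count L P loopless = begin
    sum (map (λ x → if P x then weightSum G L x else 0) vertices)
      ≡⟨ sum-map-cong vertices (λ x → if-sum (P x) x) ⟩
    sum (map (λ x → sum (map (λ e → if P x ∧ incident G x e then L e else 0) edges)) vertices)
      ≡⟨ sum-map-swap vertices edges _ ⟩
    sum (map (λ e → sum (map (λ x → if P x ∧ incident G x e then L e else 0) vertices)) edges)
      ≡⟨ sum-map-cong edges (λ e → trans (sum-map-cong vertices (λ x → if≡*indicator (P x ∧ incident G x e) (L e)))
                                         (sum-map-*ˡ (L e) _ vertices)) ⟩
    sum (map (λ e → L e * sum (map (λ x → indicator (P x ∧ incident G x e)) vertices)) edges)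
      ≡⟨ sum-map-cong edges (λ e → cong (L e *_) (incidence-count P e (loopless e))) ⟩
    sum (map (λ e → L e * (indicator (P (end₁ G e)) + indicator (P (end₂ G e)))) edges)
      ∎
    where
    open ≡-Reasoning
    if-sum : ∀ p x → (if p then weightSum G L x else 0)
                     ≡ sum (map (λ e → if p ∧ incident G x e then L e else 0) edges)
    if-sum true  x = refl
    if-sum false x = sym (sum-map-zero edges)

module TwoSums (G : Graph) (f : Graph.E G ⤖ Fin (size G)) (antimagic : IsLocalAntimagic G f)
  (a b : ℕ) (two-sums : ∀ x → vsum G f x ≡ a ⊎ vsum G f x ≡ b) where
  open Graph G

  sumIsA : V → Bool
  sumIsA x = vsum G f x ≡ᵇ a

  sumIsA-true : ∀ {x} → sumIsA x ≡ true → vsum G f x ≡ a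
  sumIsA-true {x} eq = ≡ᵇ⇒≡ (vsum G f x) a (subst T (sym eq) _)

  sumIsA-false : ∀ {x} → sumIsA x ≡ false → vsum G f x ≡ b
  sumIsA-false {x} eq with two-sums x
  ... | inj₁ s≡a = ⊥-elim (subst T eq (≡⇒≡ᵇ (vsum G f x) a s≡a))
  ... | inj₂ s≡b = s≡b

  sumIsA-edge : ∀ e → sumIsA (end₁ G e) ≡ not (sumIsA (end₂ G e))
  sumIsA-edge e with sumIsA (end₁ G e) in eq₁ | sumIsA (end₂ G e) in eq₂
  ... | true  | true  = ⊥-elim (antimagic e (trans (sumIsA-true eq₁) (sym (sumIsA-true eq₂))))
  ... | true  | false = refl
  ... | false | true  = refl
  ... | false | false = ⊥-elim (antimagic e (trans (sumIsA-false eq₁) (sym (sumIsA-false eq₂))))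

  twoSums⇒properColouring : Σ (V → Fin 2) (ProperColouring G 2)
  twoSums⇒properColouring = colour , λ e → distinct {sumIsA (end₁ G e)} {sumIsA (end₂ G e)} (sumIsA-edge e)
    where
    colour : V → Fin 2
    colour x = if sumIsA x then zero else suc zero
    distinct : ∀ {p q} → p ≡ not q → _≢_ {A = Fin 2} (if p then zero else suc zero) (if q then zero else suc zero)
    distinct {false} {true}  _ ()
    distinct {true}  {false} _ ()

  twoSums⇒¬chromaticNumber3 : ¬ ChromaticNumber3 G
  twoSums⇒¬chromaticNumber3 (_ , no2colouring) = no2colouring (proj₁ twoSums⇒properColouring) (proj₂ twoSums⇒properColouring)

  module _ (vertices-complete : ∀ x → x ∈ vertices) (edges-complete : ∀ e → e ∈ edges)
    (vertices-once : ∀ x → occurrences G x ≡ 1) where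
    open Components G vertices-complete edges-complete using (reach-refl; reach-invariant; sameComponent-edge)
    open DoubleCounting G vertices-once using (double-count)

    module BalancedComponent (x₀ : V) (c : V → Fin 2) (proper : ProperColouring G 2 c)
      (balanced : componentColourCount G c x₀ zero ≡ componentColourCount G c x₀ (suc zero)) where

      inC isZero parity inA inB : V → Bool
      inC x    = sameComponent G x₀ x
      isZero x = does (c x F.≟ zero)
      parity x = sumIsA x xor isZero x
      inA x    = inC x ∧ sumIsA x
      inB x    = inC x ∧ not (sumIsA x)

      count : (V → Bool) → ℕ
      count P = length (filterᵇ P vertices)

      -- On the component the 2-colouring by sums agrees with c or with its swap.
      parity-edge : ∀ e → parity (end₁ G e) ≡ parity (end₂ G e)
      parity-edge e = begin
        sumIsA (end₁ G e) xor isZero (end₁ G e)             ≡⟨ cong₂ _xor_ (sumIsA-edge e) (colour-flips (proper e)) ⟩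
        not (sumIsA (end₂ G e)) xor not (isZero (end₂ G e)) ≡⟨ not-xor-not (sumIsA (end₂ G e)) _ ⟩
        sumIsA (end₂ G e) xor isZero (end₂ G e)             ∎
        where
        open ≡-Reasoning
        colour-flips : ∀ {i j : Fin 2} → i ≢ j → does (i F.≟ zero) ≡ not (does (j F.≟ zero))
        colour-flips {zero}     {zero}     i≢j = ⊥-elim (i≢j refl)
        colour-flips {zero}     {suc zero} _   = refl
        colour-flips {suc zero} {zero}     _   = refl
        colour-flips {suc zero} {suc zero} i≢j = ⊥-elim (i≢j refl)
        not-xor-not : ∀ p q → not p xor not q ≡ p xor q
        not-xor-not true  q     = refl
        not-xor-not false true  = refl
        not-xor-not false false = refl

      sumIsA-on-C : ∀ x → T (inC x) → sumIsA x ≡ parity x₀ xor isZero x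
      sumIsA-on-C x x∈C = trans (sym (xor-cancel (sumIsA x) (isZero x)))
                                (cong (_xor isZero x) (sym (reach-invariant parity parity-edge (length vertices) x∈C)))
        where
        xor-cancel : ∀ p q → (p xor q) xor q ≡ p
        xor-cancel true  true  = refl
        xor-cancel true  false = refl
        xor-cancel false true  = refl
        xor-cancel false false = refl

      inA≡ : ∀ x → inA x ≡ inC x ∧ (parity x₀ xor isZero x)
      inA≡ x = ∧-congʳ-under (inC x) (sumIsA-on-C x)

      inB≡ : ∀ x → inB x ≡ inC x ∧ not (parity x₀ xor isZero x)
      inB≡ x = ∧-congʳ-under (inC x) (cong not ∘ sumIsA-on-C x)

      isOne≡ : ∀ x → not (isZero x) ≡ does (c x F.≟ suc zero)
      isOne≡ x with c x
      ... | zero     = refl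
      ... | suc zero = refl

      countA≡countB : count inA ≡ count inB
      countA≡countB with parity x₀ | inA≡ | inB≡
      ... | false | A≡ | B≡ = begin
        count inA
          ≡⟨ length-filterᵇ-cong inA _ vertices A≡ ⟩
        componentColourCount G c x₀ zero
          ≡⟨ balanced ⟩
        componentColourCount G c x₀ (suc zero)
          ≡⟨ length-filterᵇ-cong _ inB vertices (λ x → sym (trans (B≡ x) (cong (inC x ∧_) (isOne≡ x)))) ⟩
        count inB
          ∎
        where open ≡-Reasoning
      ... | true | A≡ | B≡ = begin
        count inA
          ≡⟨ length-filterᵇ-cong inA _ vertices (λ x → trans (A≡ x) (cong (inC x ∧_) (isOne≡ x))) ⟩
        componentColourCount G c x₀ (suc zero)
          ≡⟨ balanced ⟨
        componentColourCount G c x₀ zero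
          ≡⟨ length-filterᵇ-cong _ inB vertices (λ x → sym (trans (B≡ x) (cong (inC x ∧_) (not-involutive (isZero x))))) ⟩
        count inB
          ∎
        where open ≡-Reasoning

      x₀∈C : T (inC x₀)
      x₀∈C = reach-refl (length vertices) x₀

      countA-positive : 1 ≤ count inA
      countA-positive with sumIsA x₀ in x₀∈A
      ... | true  = length-filterᵇ-nonempty inA vertices (vertices-complete x₀) (T-∧⁺ x₀∈C (subst T (sym x₀∈A) _))
      ... | false = subst (1 ≤_) (sym countA≡countB)
        (length-filterᵇ-nonempty inB vertices (vertices-complete x₀) (T-∧⁺ x₀∈C (subst (T ∘ not) (sym x₀∈A) _)))

      edge-balanced : ∀ e → indicator (inA (end₁ G e)) + indicator (inA (end₂ G e))
                            ≡ indicator (inB (end₁ G e)) + indicator (inB (end₂ G e))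
      edge-balanced e = flip-balance (sameComponent-edge x₀ e) (sumIsA-edge e)
        where
        flip-balance : ∀ {c₁ c₂ s₁ s₂} → c₁ ≡ c₂ → s₁ ≡ not s₂ →
                       indicator (c₁ ∧ s₁) + indicator (c₂ ∧ s₂) ≡ indicator (c₁ ∧ not s₁) + indicator (c₂ ∧ not s₂)
        flip-balance {false} refl refl = refl
        flip-balance {true} {s₂ = true}  refl refl = refl
        flip-balance {true} {s₂ = false} refl refl = refl

      sum-over-A : sum (map (λ x → if inA x then vsum G f x else 0) vertices) ≡ a * count inA
      sum-over-A = sum-if-const inA (vsum G f) a vertices (λ x → sumIsA-true ∘ T⇒≡ ∘ proj₂ ∘ T-∧⁻ (inC x))

      sum-over-B : sum (map (λ x → if inB x then vsum G f x else 0) vertices) ≡ b * count inB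
      sum-over-B = sum-if-const inB (vsum G f) b vertices (λ x → sumIsA-false ∘ T-not⇒≡ ∘ proj₂ ∘ T-∧⁻ (inC x))

      a≡b : a ≡ b
      a≡b = *-cancelʳ-≡ a b (count inA) {{ℕ.>-nonZero countA-positive}} (begin
        a * count inA
          ≡⟨ sum-over-A ⟨
        sum (map (λ x → if inA x then vsum G f x else 0) vertices)
          ≡⟨ double-count (label G f) inA loopless ⟩
        sum (map (λ e → label G f e * (indicator (inA (end₁ G e)) + indicator (inA (end₂ G e)))) edges)
          ≡⟨ sum-map-cong edges (λ e → cong (label G f e *_) (edge-balanced e)) ⟩
        sum (map (λ e → label G f e * (indicator (inB (end₁ G e)) + indicator (inB (end₂ G e)))) edges)
          ≡⟨ double-count (label G f) inB loopless ⟨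
        sum (map (λ x → if inB x then vsum G f x else 0) vertices)
          ≡⟨ sum-over-B ⟩
        b * count inB
          ≡⟨ cong (b *_) countA≡countB ⟨
        b * count inA
          ∎)
        where
        open ≡-Reasoning
        loopless : ∀ e → end₁ G e ≢ end₂ G e
        loopless e ends-equal = antimagic e (cong (vsum G f) ends-equal)

    twoSums⇒¬balancedBipartite : E → ¬ BalancedBipartite G
    twoSums⇒¬balancedBipartite e₀ (c , proper , balanced) =
      antimagic e₀ (trans (sum≡a (end₁ G e₀)) (sym (sum≡a (end₂ G e₀))))
      where
      open BalancedComponent (end₁ G e₀) c proper (balanced (end₁ G e₀)) using (a≡b)
      sum≡a : ∀ x → vsum G f x ≡ a
      sum≡a x with two-sums x
      ... | inj₁ s≡a = s≡a
      ... | inj₂ s≡b = trans s≡b (sym a≡b)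

-- The graph G

module Positions (k : ℕ) where

  k≡1*k : k ≡ 1 * k
  k≡1*k = sym (*-identityˡ k)

  position : (p : Fin (2 * k)) → (∃ λ i → emb i ≡ p) ⊎ (∃ λ i → rev i ≡ p)
  position = ↑ˡ-or-opposite k (1 * k) k≡1*k

  emb-injective : ∀ {i j : Fin k} → emb i ≡ emb j → i ≡ j
  emb-injective = FinP.↑ˡ-injective (1 * k) _ _

  rev-injective : ∀ {i j : Fin k} → rev i ≡ rev j → i ≡ j
  rev-injective {i} {j} eq = emb-injective (trans (sym (FinP.opposite-involutive (emb i)))
                                                  (trans (cong opposite eq) (FinP.opposite-involutive (emb j))))

  emb≢rev : ∀ (i j : Fin k) → emb i ≢ rev j
  emb≢rev = ↑ˡ≢opposite-↑ˡ k (1 * k) k≡1*k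

  ∑-emb+rev : ∀ (f : Fin (2 * k) → ℕ) → ∑[ i < k ] f (emb i) + ∑[ i < k ] f (rev i) ≡ ∑[ q < 2 * k ] f q
  ∑-emb+rev = ∑-↑ˡ+opposite k (1 * k) k≡1*k

Slot : ℕ → ℕ → Set
Slot k n = Fin (2 * k) × Fin (2 * n) × Bool

module EdgeView (k n : ℕ) where
  open Positions k

  -- A path edge is recorded by the position of its u-endpoint, its path index, and whether it is
  -- the u-edge of its path.
  toSlot : EH k n → Fin (2 * k) ⊎ Slot k n
  toSlot (uv q)   = inj₁ q
  toSlot (uy i j) = inj₂ (emb i , j , true)
  toSlot (vy i j) = inj₂ (emb i , j , false)
  toSlot (vz i j) = inj₂ (rev i , j , false)
  toSlot (uz i j) = inj₂ (rev i , j , true)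

  fromSlot : Fin (2 * k) ⊎ Slot k n → EH k n
  fromSlot (inj₁ q) = uv q
  fromSlot (inj₂ (p , j , s)) with position p
  ... | inj₁ (i , _) = if s then uy i j else vy i j
  ... | inj₂ (i , _) = if s then uz i j else vz i j

  toSlot-fromSlot : ∀ x → toSlot (fromSlot x) ≡ x
  toSlot-fromSlot (inj₁ q) = refl
  toSlot-fromSlot (inj₂ (p , j , s)) with position p
  toSlot-fromSlot (inj₂ (p , j , true))  | inj₁ (i , refl) = refl
  toSlot-fromSlot (inj₂ (p , j , false)) | inj₁ (i , refl) = refl
  toSlot-fromSlot (inj₂ (p , j , true))  | inj₂ (i , refl) = refl
  toSlot-fromSlot (inj₂ (p , j , false)) | inj₂ (i , refl) = refl

  fromSlot-toSlot : ∀ e → fromSlot (toSlot e) ≡ e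
  fromSlot-toSlot (uv q) = refl
  fromSlot-toSlot (uy i j) with position (emb i)
  ... | inj₁ (i′ , eq) = cong (λ i → uy i j) (emb-injective eq)
  ... | inj₂ (i′ , eq) = ⊥-elim (emb≢rev i i′ (sym eq))
  fromSlot-toSlot (vy i j) with position (emb i)
  ... | inj₁ (i′ , eq) = cong (λ i → vy i j) (emb-injective eq)
  ... | inj₂ (i′ , eq) = ⊥-elim (emb≢rev i i′ (sym eq))
  fromSlot-toSlot (vz i j) with position (rev i)
  ... | inj₁ (i′ , eq) = ⊥-elim (emb≢rev i′ i eq)
  ... | inj₂ (i′ , eq) = cong (λ i → vz i j) (rev-injective eq)
  fromSlot-toSlot (uz i j) with position (rev i)
  ... | inj₁ (i′ , eq) = ⊥-elim (emb≢rev i′ i eq)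
  ... | inj₂ (i′ , eq) = cong (λ i → uz i j) (rev-injective eq)

  edge-view : EH k n ↔ (Fin (2 * k) ⊎ Slot k n)
  edge-view = mk↔ₛ′ toSlot fromSlot toSlot-fromSlot fromSlot-toSlot

  edges↔Fin : EH k n ↔ Fin (2 * k + 2 * k * (2 * n * 2))
  edges↔Fin = ↔-trans edge-view (↔-sym (↔-trans FinP.+↔⊎ (↔-refl ⊎-↔
                (↔-trans FinP.*↔× (↔-refl ×-↔ (↔-trans FinP.*↔× (↔-refl ×-↔ FinP.2↔Bool)))))))

module EdgeList (k n : ℕ) where

  matchings : List (EH k n)
  matchings = map uv (allFin (2 * k))

  family : (Fin k → Fin (2 * n) → EH k n) → List (EH k n)
  family e = concatMap (λ i → map (e i) (allFin (2 * n))) (allFin k)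

  grid : (Fin k → Fin (2 * n) → ℕ) → ℕ
  grid f = ∑[ i < k ] ∑[ j < 2 * n ] f i j

  grid-zero : grid (λ _ _ → 0) ≡ 0
  grid-zero = trans (sum-cong-≗ {k} (λ _ → ∑-zero (2 * n))) (∑-zero k)

  grid-δ : ∀ i j (f : Fin k → Fin (2 * n) → ℕ) →
           grid (λ i′ j′ → if does (i F.≟ i′) ∧ does (j F.≟ j′) then f i′ j′ else 0) ≡ f i j
  grid-δ i j f = trans (sum-cong-≗ {k} row) (∑-δ i (λ i′ → f i′ j))
    where
    row : ∀ i′ → ∑[ j′ < 2 * n ] (if does (i F.≟ i′) ∧ does (j F.≟ j′) then f i′ j′ else 0)
                 ≡ (if does (i F.≟ i′) then f i′ j else 0)
    row i′ with does (i F.≟ i′)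
    ... | true  = ∑-δ j (f i′)
    ... | false = ∑-zero (2 * n)

  sum-edgesList : ∀ (h : EH k n → ℕ) → sum (map h (edgesList k n)) ≡
    ∑[ q < 2 * k ] h (uv q) + (grid (λ i j → h (uy i j)) + (grid (λ i j → h (vy i j))
                             + (grid (λ i j → h (vz i j)) + grid (λ i j → h (uz i j)))))
  sum-edgesList h =
    trans (sum-map-++ h matchings _) (cong₂ _+_ (sum-map-allFin uv) (
    trans (sum-map-++ h (family uy) _) (cong₂ _+_ (sum-family uy) (
    trans (sum-map-++ h (family vy) _) (cong₂ _+_ (sum-family vy) (
    trans (sum-map-++ h (family vz) _) (cong₂ _+_ (sum-family vz) (sum-family uz))))))))
    where
    sum-family : ∀ e → sum (map h (family e)) ≡ grid (λ i j → h (e i j))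
    sum-family e = sum-concatMap-allFin k (2 * n) e h
    sum-map-allFin : ∀ (e : Fin (2 * k) → EH k n) → sum (map h (map e (allFin (2 * k)))) ≡ ∑[ q < 2 * k ] h (e q)
    sum-map-allFin e = trans (cong sum (sym (map-∘ (allFin (2 * k))))) (sum-allFin (2 * k) (h ∘ e))

  edges-complete : ∀ e → e ∈ edgesList k n
  edges-complete (uv q)   = ∈-++⁺ˡ (∈-map⁺ uv (∈-allFin q))
  edges-complete (uy i j) = ∈-++⁺ʳ matchings (∈-++⁺ˡ (∈-family uy i j))
  edges-complete (vy i j) = ∈-++⁺ʳ matchings (∈-++⁺ʳ (family uy) (∈-++⁺ˡ (∈-family vy i j)))
  edges-complete (vz i j) = ∈-++⁺ʳ matchings (∈-++⁺ʳ (family uy) (∈-++⁺ʳ (family vy) (∈-++⁺ˡ (∈-family vz i j))))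
  edges-complete (uz i j) =
    ∈-++⁺ʳ matchings (∈-++⁺ʳ (family uy) (∈-++⁺ʳ (family vy) (∈-++⁺ʳ (family vz) (∈-family uz i j))))

  length-edgesList : length (edgesList k n) ≡ 2 * k + 2 * k * (2 * n * 2)
  length-edgesList = begin
    length (edgesList k n)                               ≡⟨ length≡sum-map-1 (edgesList k n) ⟩
    sum (map (λ _ → 1) (edgesList k n))                  ≡⟨ sum-edgesList (λ _ → 1) ⟩
    ∑[ q < 2 * k ] 1 + (grid1 + (grid1 + (grid1 + grid1)))
      ≡⟨ cong₂ _+_ (∑-const (2 * k) 1) (cong₂ _+_ grid1≡ (cong₂ _+_ grid1≡ (cong₂ _+_ grid1≡ grid1≡))) ⟩
    2 * k * 1 + (g + (g + (g + g)))                      ≡⟨ count k n ⟩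
    2 * k + 2 * k * (2 * n * 2)                          ∎
    where
    open ≡-Reasoning
    grid1 g : ℕ
    grid1 = grid (λ _ _ → 1)
    g = k * (2 * n * 1)
    grid1≡ : grid1 ≡ g
    grid1≡ = trans (sum-cong-≗ {k} (λ _ → ∑-const (2 * n) 1)) (∑-const k (2 * n * 1))
    count : ∀ k n → let g = k * (2 * n * 1) in 2 * k * 1 + (g + (g + (g + g))) ≡ 2 * k + 2 * k * (2 * n * 2)
    count = solve-∀

module QuotientGraph (k n m : ℕ) (b : Fin (2 * k) → Fin m) where
  open EdgeList k n public
  open Positions k using (∑-emb+rev)

  G : Graph
  G = Gquot k n m b

  _≟V_ : DecidableEquality (VG k n m)
  _≟V_ = _≟G_

  ≟G-u : ∀ p q → does (_≟G_ {k} {n} {m} (u p) (u q)) ≡ does (p F.≟ q)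
  ≟G-u p q with p F.≟ q
  ... | yes refl = refl
  ... | no  _    = refl

  ≟G-w : ∀ c d → does (_≟G_ {k} {n} {m} (w c) (w d)) ≡ does (c F.≟ d)
  ≟G-w c d with c F.≟ d
  ... | yes refl = refl
  ... | no  _    = refl

  ≟G-y : ∀ i j i′ j′ → does (_≟G_ {k} {n} {m} (y i j) (y i′ j′)) ≡ does (i F.≟ i′) ∧ does (j F.≟ j′)
  ≟G-y i j i′ j′ with i F.≟ i′ | j F.≟ j′
  ... | yes refl | yes refl = refl
  ... | yes refl | no  _    = refl
  ... | no  _    | _        = refl

  ≟G-z : ∀ i j i′ j′ → does (_≟G_ {k} {n} {m} (z i j) (z i′ j′)) ≡ does (i F.≟ i′) ∧ does (j F.≟ j′)
  ≟G-z i j i′ j′ with i F.≟ i′ | j F.≟ j′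
  ... | yes refl | yes refl = refl
  ... | yes refl | no  _    = refl
  ... | no  _    | _        = refl

  sum-verticesG : ∀ (h : VG k n m → ℕ) → sum (map h (verticesG k n m)) ≡
    ∑[ p < 2 * k ] h (u p) + (∑[ c < m ] h (w c) + (grid (λ i j → h (y i j)) + grid (λ i j → h (z i j))))
  sum-verticesG h =
    trans (sum-map-++ h (map u (allFin (2 * k))) _) (cong₂ _+_ (sum-map-allFin (2 * k) u) (
    trans (sum-map-++ h (map w (allFin m)) _) (cong₂ _+_ (sum-map-allFin m w) (
    trans (sum-map-++ h (concatMap (λ i → map (y i) (allFin (2 * n))) (allFin k)) _)
          (cong₂ _+_ (sum-concatMap-allFin k (2 * n) y h) (sum-concatMap-allFin k (2 * n) z h))))))
    where
    sum-map-allFin : ∀ a (e : Fin a → VG k n m) → sum (map h (map e (allFin a))) ≡ ∑[ q < a ] h (e q)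
    sum-map-allFin a e = trans (cong sum (sym (map-∘ (allFin a)))) (sum-allFin a (h ∘ e))

  vertices-once : ∀ x → occurrences G x ≡ 1
  vertices-once (u p) = begin
    _                                              ≡⟨ sum-verticesG _ ⟩
    ∑[ q < 2 * k ] (if does (u q ≟V u p) then 1 else 0) + (∑[ c < m ] 0 + (grid (λ _ _ → 0) + grid (λ _ _ → 0)))
      ≡⟨ cong₂ _+_ (trans (sum-cong-≗ {2 * k} (λ q → cong (λ t → if t then 1 else 0) (trans (≟G-u q p) (does-sym q p))))
                          (∑-δ p (λ _ → 1)))
                   (cong₂ _+_ (∑-zero m) (cong₂ _+_ grid-zero grid-zero)) ⟩
    1                                              ∎
    where open ≡-Reasoning
  vertices-once (w c) = begin
    _                                              ≡⟨ sum-verticesG _ ⟩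
    ∑[ q < 2 * k ] 0 + (∑[ d < m ] (if does (w d ≟V w c) then 1 else 0) + (grid (λ _ _ → 0) + grid (λ _ _ → 0)))
      ≡⟨ cong₂ _+_ (∑-zero (2 * k))
                   (cong₂ _+_ (trans (sum-cong-≗ {m} (λ d → cong (λ t → if t then 1 else 0) (trans (≟G-w d c) (does-sym d c))))
                                     (∑-δ c (λ _ → 1)))
                              (cong₂ _+_ grid-zero grid-zero)) ⟩
    1                                              ∎
    where open ≡-Reasoning
  vertices-once (y i j) = begin
    _                                              ≡⟨ sum-verticesG _ ⟩
    ∑[ q < 2 * k ] 0 + (∑[ c < m ] 0 + (grid (λ i′ j′ → if does (y i′ j′ ≟V y i j) then 1 else 0) + grid (λ _ _ → 0)))
      ≡⟨ cong₂ _+_ (∑-zero (2 * k)) (cong₂ _+_ (∑-zero m) (cong₂ _+_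
           (trans (sum-cong-≗ {k} λ i′ → sum-cong-≗ {2 * n} λ j′ →
                     cong (λ t → if t then 1 else 0) (trans (≟G-y i′ j′ i j) (cong₂ _∧_ (does-sym i′ i) (does-sym j′ j))))
                  (grid-δ i j (λ _ _ → 1)))
           grid-zero)) ⟩
    1                                              ∎
    where open ≡-Reasoning
  vertices-once (z i j) = begin
    _                                              ≡⟨ sum-verticesG _ ⟩
    ∑[ q < 2 * k ] 0 + (∑[ c < m ] 0 + (grid (λ _ _ → 0) + grid (λ i′ j′ → if does (z i′ j′ ≟V z i j) then 1 else 0)))
      ≡⟨ cong₂ _+_ (∑-zero (2 * k)) (cong₂ _+_ (∑-zero m) (cong₂ _+_ grid-zero
           (trans (sum-cong-≗ {k} λ i′ → sum-cong-≗ {2 * n} λ j′ →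
                     cong (λ t → if t then 1 else 0) (trans (≟G-z i′ j′ i j) (cong₂ _∧_ (does-sym i′ i) (does-sym j′ j))))
                  (grid-δ i j (λ _ _ → 1))))) ⟩
    1                                              ∎
    where open ≡-Reasoning

  vertices-complete : ∀ x → x ∈ verticesG k n m
  vertices-complete x = ∈-from-occurrences _≟V_ (verticesG k n m) (≤-reflexive (sym (vertices-once x)))

  module _ (A B : Fin (2 * k) → Fin (2 * n) → ℕ) (C : Fin (2 * k) → ℕ) where

    positional : EH k n → ℕ
    positional (uv q)   = C q
    positional (uy i j) = A (emb i) j
    positional (vy i j) = B (emb i) j
    positional (vz i j) = B (rev i) j
    positional (uz i j) = A (rev i) j

    weightSum-y : ∀ i j → weightSum G positional (y i j) ≡ A (emb i) j + B (emb i) j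
    weightSum-y i j = begin
      weightSum G positional (y i j)
        ≡⟨ sum-edgesList _ ⟩
      ∑[ q < 2 * k ] 0 + (grid (λ i′ j′ → if does (y i j ≟V y i′ j′) then A (emb i′) j′ else 0)
                         + (grid (λ i′ j′ → if does (y i j ≟V y i′ j′) then B (emb i′) j′ else 0)
                         + (grid (λ _ _ → 0) + grid (λ _ _ → 0))))
        ≡⟨ cong₂ _+_ (∑-zero (2 * k)) (cong₂ _+_ (at-y (λ i′ j′ → A (emb i′) j′))
                                     (cong₂ _+_ (at-y (λ i′ j′ → B (emb i′) j′)) (cong₂ _+_ grid-zero grid-zero))) ⟩
      A (emb i) j + (B (emb i) j + 0)
        ≡⟨ cong (A (emb i) j +_) (+-identityʳ _) ⟩
      A (emb i) j + B (emb i) j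
        ∎
      where
      open ≡-Reasoning
      at-y : ∀ f → grid (λ i′ j′ → if does (y i j ≟V y i′ j′) then f i′ j′ else 0) ≡ f i j
      at-y f = trans (sum-cong-≗ {k} λ i′ → sum-cong-≗ {2 * n} λ j′ →
                       cong (λ t → if t then f i′ j′ else 0) (≟G-y i j i′ j′))
                     (grid-δ i j f)

    weightSum-z : ∀ i j → weightSum G positional (z i j) ≡ A (rev i) j + B (rev i) j
    weightSum-z i j = begin
      weightSum G positional (z i j)
        ≡⟨ sum-edgesList _ ⟩
      ∑[ q < 2 * k ] 0 + (grid (λ _ _ → 0) + (grid (λ _ _ → 0)
                         + (grid (λ i′ j′ → if does (z i j ≟V z i′ j′) then B (rev i′) j′ else 0)
                         + grid (λ i′ j′ → if does (z i j ≟V z i′ j′) then A (rev i′) j′ else 0))))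
        ≡⟨ cong₂ _+_ (∑-zero (2 * k)) (cong₂ _+_ grid-zero (cong₂ _+_ grid-zero
             (cong₂ _+_ (at-z (λ i′ j′ → B (rev i′) j′)) (at-z (λ i′ j′ → A (rev i′) j′))))) ⟩
      B (rev i) j + A (rev i) j
        ≡⟨ +-comm (B (rev i) j) _ ⟩
      A (rev i) j + B (rev i) j
        ∎
      where
      open ≡-Reasoning
      at-z : ∀ f → grid (λ i′ j′ → if does (z i j ≟V z i′ j′) then f i′ j′ else 0) ≡ f i j
      at-z f = trans (sum-cong-≗ {k} λ i′ → sum-cong-≗ {2 * n} λ j′ →
                       cong (λ t → if t then f i′ j′ else 0) (≟G-z i j i′ j′))
                     (grid-δ i j f)

    weightSum-u : ∀ p → weightSum G positional (u p) ≡ C p + ∑[ j < 2 * n ] A p j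
    weightSum-u p = begin
      weightSum G positional (u p)
        ≡⟨ sum-edgesList _ ⟩
      ∑[ q < 2 * k ] (if does (u p ≟V u q) ∨ false then C q else 0)
        + (path-edges emb + (grid (λ _ _ → 0) + (grid (λ _ _ → 0) + path-edges rev)))
        ≡⟨ cong₂ _+_ matching-edge (cong₂ _+_ (path-edges≡ emb) (cong₂ _+_ grid-zero (cong₂ _+_ grid-zero (path-edges≡ rev)))) ⟩
      C p + (∑[ i < k ] row (emb i) + ∑[ i < k ] row (rev i))
        ≡⟨ cong (C p +_) (trans (∑-emb+rev row) (∑-δ p (λ q → ∑[ j < 2 * n ] A q j))) ⟩
      C p + ∑[ j < 2 * n ] A p j
        ∎
      where
      open ≡-Reasoning
      at-u : ∀ q x → (if does (u p ≟V u q) ∨ false then x else 0) ≡ (if does (p F.≟ q) then x else 0)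
      at-u q x = cong (λ t → if t then x else 0) (trans (∨-identityʳ _) (≟G-u p q))
      matching-edge : ∑[ q < 2 * k ] (if does (u p ≟V u q) ∨ false then C q else 0) ≡ C p
      matching-edge = trans (sum-cong-≗ {2 * k} (λ q → at-u q (C q))) (∑-δ p C)
      row : Fin (2 * k) → ℕ
      row q = if does (p F.≟ q) then ∑[ j < 2 * n ] A q j else 0
      path-edges : (Fin k → Fin (2 * k)) → ℕ
      path-edges φ = grid (λ i j → if does (u p ≟V u (φ i)) ∨ false then A (φ i) j else 0)
      path-edges≡ : ∀ φ → path-edges φ ≡ ∑[ i < k ] row (φ i)
      path-edges≡ φ = sum-cong-≗ {k} λ i →
        trans (sum-cong-≗ {2 * n} (λ j → at-u (φ i) _)) (∑-if (2 * n) (does (p F.≟ φ i)) (A (φ i)))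

    weightSum-w : ∀ c → weightSum G positional (w c)
                        ≡ ∑[ q < 2 * k ] (if does (c F.≟ b q) then C q + ∑[ j < 2 * n ] B (opposite q) j else 0)
    weightSum-w c = begin
      weightSum G positional (w c)
        ≡⟨ sum-edgesList _ ⟩
      ∑[ q < 2 * k ] (if does (w c ≟V w (b q)) then C q else 0)
        + (grid (λ _ _ → 0) + (path-edges rev emb + (path-edges emb rev + grid (λ _ _ → 0))))
        ≡⟨ cong₂ _+_ matching-edges
             (cong₂ _+_ grid-zero (cong₂ _+_ (path-edges≡ rev emb (FinP.opposite-involutive ∘ emb))
                                            (trans (cong₂ _+_ (path-edges≡ emb rev (λ _ → refl)) grid-zero) (+-identityʳ _)))) ⟩
      ∑[ q < 2 * k ] (if does (c F.≟ b q) then C q else 0) + (∑[ i < k ] H (rev i) + ∑[ i < k ] H (emb i))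
        ≡⟨ cong (∑[ q < 2 * k ] (if does (c F.≟ b q) then C q else 0) +_)
                (trans (+-comm (∑[ i < k ] H (rev i)) _) (∑-emb+rev H)) ⟩
      ∑[ q < 2 * k ] (if does (c F.≟ b q) then C q else 0) + ∑[ q < 2 * k ] H q
        ≡⟨ ∑-distrib-+ (λ q → if does (c F.≟ b q) then C q else 0) H ⟨
      ∑[ q < 2 * k ] ((if does (c F.≟ b q) then C q else 0) + H q)
        ≡⟨ sum-cong-≗ {2 * k} (λ q → if-+ (does (c F.≟ b q))) ⟩
      ∑[ q < 2 * k ] (if does (c F.≟ b q) then C q + ∑[ j < 2 * n ] B (opposite q) j else 0)
        ∎
      where
      open ≡-Reasoning
      matching-edges : ∑[ q < 2 * k ] (if does (w c ≟V w (b q)) then C q else 0)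
                       ≡ ∑[ q < 2 * k ] (if does (c F.≟ b q) then C q else 0)
      matching-edges = sum-cong-≗ {2 * k} (λ q → cong (λ t → if t then C q else 0) (≟G-w c (b q)))
      H : Fin (2 * k) → ℕ
      H q = if does (c F.≟ b q) then ∑[ j < 2 * n ] B (opposite q) j else 0
      path-edges : (Fin k → Fin (2 * k)) → (Fin k → Fin (2 * k)) → ℕ
      path-edges φ ψ = grid (λ i j → if does (w c ≟V w (b (φ i))) ∨ false then B (ψ i) j else 0)
      path-edges≡ : ∀ φ ψ → (∀ i → opposite (φ i) ≡ ψ i) → path-edges φ ψ ≡ ∑[ i < k ] H (φ i)
      path-edges≡ φ ψ opp = sum-cong-≗ {k} λ i → begin
        ∑[ j < 2 * n ] (if does (w c ≟V w (b (φ i))) ∨ false then B (ψ i) j else 0)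
          ≡⟨ sum-cong-≗ {2 * n} (λ j → cong (λ t → if t then B (ψ i) j else 0) (trans (∨-identityʳ _) (≟G-w c (b (φ i))))) ⟩
        ∑[ j < 2 * n ] (if does (c F.≟ b (φ i)) then B (ψ i) j else 0)
          ≡⟨ ∑-if (2 * n) (does (c F.≟ b (φ i))) (B (ψ i)) ⟩
        (if does (c F.≟ b (φ i)) then ∑[ j < 2 * n ] B (ψ i) j else 0)
          ≡⟨ cong (λ q → if does (c F.≟ b (φ i)) then ∑[ j < 2 * n ] B q j else 0) (sym (opp i)) ⟩
        H (φ i)
          ∎
      if-+ : ∀ t {x y} → (if t then x else 0) + (if t then y else 0) ≡ (if t then x + y else 0)
      if-+ true  = refl
      if-+ false = refl

-- The labelling

∸-+-cancel : ∀ q x p → x + p ≤ q → q ∸ (x + p) + p ≡ q ∸ x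
∸-+-cancel q x p x+p≤q = trans (cong (_+ p) (sym (∸-+-assoc q x p)))
  (m∸n+n≡m (subst (_≤ q ∸ x) (m+n∸m≡n x p) (∸-monoˡ-≤ x x+p≤q)))

sumBelow : ℕ → (ℕ → ℕ) → ℕ
sumBelow zero    f = 0
sumBelow (suc m) f = f 0 + sumBelow m (f ∘ suc)

∑-toℕ : ∀ m (f : ℕ → ℕ) → ∑[ j < m ] f (toℕ j) ≡ sumBelow m f
∑-toℕ zero    f = refl
∑-toℕ (suc m) f = cong (f 0 +_) (∑-toℕ m (f ∘ suc))

sumBelow-+ : ∀ a b f → sumBelow (a + b) f ≡ sumBelow a f + sumBelow b (λ j → f (a + j))
sumBelow-+ zero    b f = refl
sumBelow-+ (suc a) b f = trans (cong (f 0 +_) (sumBelow-+ a b (f ∘ suc))) (sym (+-assoc (f 0) _ _))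

sumBelow-cong : ∀ a {f g} → (∀ j → j < a → f j ≡ g j) → sumBelow a f ≡ sumBelow a g
sumBelow-cong zero    eq = refl
sumBelow-cong (suc a) eq = cong₂ _+_ (eq 0 (s≤s z≤n)) (sumBelow-cong a (λ j j<a → eq (suc j) (s≤s j<a)))

sumBelow-mono : ∀ a {f g} → (∀ j → j < a → f j ≤ g j) → sumBelow a f ≤ sumBelow a g
sumBelow-mono zero    le = z≤n
sumBelow-mono (suc a) le = +-mono-≤ (le 0 (s≤s z≤n)) (sumBelow-mono a (λ j j<a → le (suc j) (s≤s j<a)))

sumBelow-distrib : ∀ a f g → sumBelow a (λ j → f j + g j) ≡ sumBelow a f + sumBelow a g
sumBelow-distrib zero    f g = refl
sumBelow-distrib (suc a) f g =
  trans (cong (f 0 + g 0 +_) (sumBelow-distrib a (f ∘ suc) (g ∘ suc))) (interchange (f 0) (g 0) _ _)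

sumBelow-const : ∀ a c → sumBelow a (λ _ → c) ≡ a * c
sumBelow-const zero    c = refl
sumBelow-const (suc a) c = cong (c +_) (sumBelow-const a c)

sumBelow-suc : ∀ a f → sumBelow a (λ j → suc (f j)) ≡ a + sumBelow a f
sumBelow-suc a f = trans (sumBelow-distrib a (λ _ → 1) f) (cong (_+ sumBelow a f) (trans (sumBelow-const a 1) (*-identityʳ a)))

module Labelling (k₀ n₀ : ℕ) where

  k n K N X Q : ℕ
  k = suc k₀
  n = suc n₀
  K = 2 * k
  N = 2 * n
  X = K * (n + n₀)
  Q = X + 2 * K + X

  open EdgeView k n

  low high : ℕ → ℕ → ℕ
  low  p j = K * j + p
  high p j = Q ∸ suc (low p j)

  -- 0-based labels of the path edges (the label of an edge is one more).  In every row j but the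
  -- last, the path at position p carries the low label K j + p and its mirror high p j, and its
  -- u-edge takes the low one exactly in the first n rows.  The last row uses the middle 2K
  -- labels, interleaved so that its u-labels fall by 2 per step in p; altogether uRows p + p
  -- does not depend on p.
  slotLabel : ℕ → ℕ → Bool → ℕ
  slotLabel p j true  = if suc j <ᵇ N then (if j <ᵇ n then low p j else high p j) else X + 2 * (K ∸ suc p)
  slotLabel p j false = if suc j <ᵇ N then (if j <ᵇ n then high p j else low p j) else X + suc (2 * p)

  N≡ : N ≡ suc (n + n₀)
  N≡ = trans (cong (n +_) (+-identityʳ n)) (+-suc n n₀)

  last-row : ∀ {j} → j < N → ¬ (suc j < N) → j ≡ n + n₀
  last-row {j} j<N ¬sj<N = ≤-antisym (≤-pred (subst (suc j ≤_) N≡ j<N)) (≤-pred (subst (_≤ suc j) N≡ (≮⇒≥ ¬sj<N)))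

  n<N : n < N
  n<N = subst (n <_) (sym (cong (n +_) (+-identityʳ n))) (m<m+n n (s≤s z≤n))

  data Row (j : ℕ) : Set where
    lower : j < n → Row j
    upper : n ≤ j → suc j < N → Row j
    last  : j ≡ n + n₀ → Row j

  row : ∀ {j} → j < N → Row j
  row {j} j<N with j <? n | suc j <? N
  ... | yes j<n | _        = lower j<n
  ... | no  j≮n | yes sj<N = upper (≮⇒≥ j≮n) sj<N
  ... | no  _   | no  sj≮N = last (last-row j<N sj≮N)

  lower-ordinary : ∀ {j} → j < n → suc j < N
  lower-ordinary j<n = ≤-trans (s≤s j<n) n<N

  slotLabel-lower : ∀ {p j} s → j < n → slotLabel p j s ≡ (if s then low p j else high p j)
  slotLabel-lower true  j<n rewrite <ᵇ-true (lower-ordinary j<n) | <ᵇ-true j<n = refl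
  slotLabel-lower false j<n rewrite <ᵇ-true (lower-ordinary j<n) | <ᵇ-true j<n = refl

  slotLabel-upper : ∀ {p j} s → n ≤ j → suc j < N → slotLabel p j s ≡ (if s then high p j else low p j)
  slotLabel-upper true  n≤j sj<N rewrite <ᵇ-true sj<N | <ᵇ-false n≤j = refl
  slotLabel-upper false n≤j sj<N rewrite <ᵇ-true sj<N | <ᵇ-false n≤j = refl

  last-not-ordinary : ¬ (suc (n + n₀) < N)
  last-not-ordinary lt = <-irrefl (sym N≡) lt

  slotLabel-last-u : ∀ {p} → slotLabel p (n + n₀) true ≡ X + 2 * (K ∸ suc p)
  slotLabel-last-u rewrite <ᵇ-false (≮⇒≥ last-not-ordinary) = refl

  slotLabel-last-v : ∀ {p} → slotLabel p (n + n₀) false ≡ X + suc (2 * p)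
  slotLabel-last-v rewrite <ᵇ-false (≮⇒≥ last-not-ordinary) = refl

  low<X : ∀ {p j} → p < K → suc j < N → low p j < X
  low<X {p} {j} p<K sj<N = begin-strict
    K * j + p     <⟨ +-monoʳ-< (K * j) p<K ⟩
    K * j + K     ≡⟨ +-comm (K * j) K ⟩
    K + K * j     ≡⟨ *-suc K j ⟨
    K * suc j     ≤⟨ *-monoʳ-≤ K (≤-pred (subst (suc (suc j) ≤_) N≡ sj<N)) ⟩
    K * (n + n₀)  ∎
    where open ≤-Reasoning

  X+2K≤high : ∀ {p j} → p < K → suc j < N → X + 2 * K ≤ high p j
  X+2K≤high {p} {j} p<K sj<N = begin
    X + 2 * K                    ≡⟨ m+n∸n≡m (X + 2 * K) X ⟨
    Q ∸ X                        ≤⟨ ∸-monoʳ-≤ Q (low<X p<K sj<N) ⟩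
    Q ∸ suc (low p j)            ∎
    where open ≤-Reasoning

  low<Q : ∀ {p j} → p < K → suc j < N → low p j < Q
  low<Q p<K sj<N = <-≤-trans (low<X p<K sj<N) (≤-trans (m≤m+n _ (2 * K)) (m≤m+n _ X))

  low+high : ∀ {p j} → p < K → suc j < N → low p j + suc (high p j) ≡ Q
  low+high {p} {j} p<K sj<N = trans (+-suc (low p j) _) (m+[n∸m]≡n (low<Q p<K sj<N))

  slotLabel-pair : ∀ {p j} → p < K → j < N → slotLabel p j true + suc (slotLabel p j false) ≡ Q
  slotLabel-pair {p} {j} p<K j<N with row j<N
  ... | lower j<n rewrite slotLabel-lower {p} true j<n | slotLabel-lower {p} false j<n = low+high p<K (lower-ordinary j<n)
  ... | upper n≤j sj<N rewrite slotLabel-upper {p} true n≤j sj<N | slotLabel-upper {p} false n≤j sj<N =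
    trans (+-suc (high p j) _) (trans (cong suc (+-comm (high p j) (low p j))) (trans (sym (+-suc (low p j) _)) (low+high p<K sj<N)))
  ... | last refl rewrite slotLabel-last-u {p} | slotLabel-last-v {p} =
    trans (middle-pair X (K ∸ suc p) p) (cong (λ t → X + 2 * t + X) (m∸n+n≡m {K} {suc p} p<K))
    where
    middle-pair : ∀ x r p → x + 2 * r + suc (x + suc (2 * p)) ≡ x + 2 * (r + suc p) + x
    middle-pair = solve-∀

  slotLabel<Q : ∀ {p j} s → p < K → j < N → slotLabel p j s < Q
  slotLabel<Q {p} {j} true  p<K j<N =
    subst (slotLabel p j true <_) (slotLabel-pair p<K j<N) (m<m+n (slotLabel p j true) (s≤s z≤n))
  slotLabel<Q {p} {j} false p<K j<N =
    subst (slotLabel p j false <_) (slotLabel-pair p<K j<N) (m≤n+m (suc (slotLabel p j false)) (slotLabel p j true))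

  low-divmod : ∀ {p} j → p < K → low p j % K ≡ p × low p j / K ≡ j
  low-divmod {p} j p<K = rem , quot
    where
    p+jK : low p j ≡ p + j * K
    p+jK = trans (+-comm (K * j) p) (cong (p +_) (*-comm K j))
    rem : low p j % K ≡ p
    rem = trans (cong (_% K) p+jK) (trans ([m+kn]%n≡m%n p j K) (m<n⇒m%n≡m p<K))
    quot : low p j / K ≡ j
    quot = trans (cong (_/ K) p+jK) (trans (+-distrib-/-∣ʳ p (divides-refl j))
                                           (cong₂ _+_ (m<n⇒m/n≡0 p<K) (m*n/n≡m j K)))

  lastRowSlot : ℕ → ℕ → ℕ × ℕ × Bool
  lastRowSlot r h = if r ≡ᵇ 0 then (K ∸ suc h , n + n₀ , true) else (h , n + n₀ , false)

  lowSlot highSlot : ℕ → ℕ × ℕ × Bool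
  lowSlot  t = (t % K , t / K , (t / K <ᵇ n))
  highSlot t = (t % K , t / K , not (t / K <ᵇ n))

  decodeSlot : ℕ → ℕ × ℕ × Bool
  decodeSlot t =
    if t <ᵇ X then lowSlot t
    else if t <ᵇ X + 2 * K then lastRowSlot ((t ∸ X) % 2) ((t ∸ X) / 2)
    else highSlot (Q ∸ suc t)

  decodeSlot-low : ∀ {t} → t < X → decodeSlot t ≡ lowSlot t
  decodeSlot-low t<X rewrite <ᵇ-true t<X = refl

  decodeSlot-middle : ∀ {t} → X ≤ t → t < X + 2 * K → decodeSlot t ≡ lastRowSlot ((t ∸ X) % 2) ((t ∸ X) / 2)
  decodeSlot-middle X≤t t<X+2K rewrite <ᵇ-false X≤t | <ᵇ-true t<X+2K = refl

  decodeSlot-high : ∀ {t} → X + 2 * K ≤ t → decodeSlot t ≡ highSlot (Q ∸ suc t)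
  decodeSlot-high {t} X+2K≤t rewrite <ᵇ-false (≤-trans (m≤m+n X (2 * K)) X+2K≤t) | <ᵇ-false X+2K≤t = refl

  decode-low : ∀ {p j} → p < K → suc j < N → decodeSlot (low p j) ≡ (p , j , (j <ᵇ n))
  decode-low {p} {j} p<K sj<N = trans (decodeSlot-low (low<X p<K sj<N))
    (cong₂ (λ r q → (r , q , (q <ᵇ n))) (proj₁ (low-divmod j p<K)) (proj₂ (low-divmod j p<K)))

  decode-high : ∀ {p j} → p < K → suc j < N → decodeSlot (high p j) ≡ (p , j , not (j <ᵇ n))
  decode-high {p} {j} p<K sj<N = begin
    decodeSlot (high p j)            ≡⟨ decodeSlot-high (X+2K≤high p<K sj<N) ⟩
    highSlot (Q ∸ suc (high p j))    ≡⟨ cong highSlot (trans (cong (Q ∸_) (sym (+-∸-assoc 1 (low<Q p<K sj<N))))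
                                                            (m∸[m∸n]≡n (<⇒≤ (low<Q p<K sj<N)))) ⟩
    highSlot (low p j)               ≡⟨ cong₂ (λ r q → (r , q , not (q <ᵇ n))) (proj₁ (low-divmod j p<K))
                                                                                 (proj₂ (low-divmod j p<K)) ⟩
    (p , j , not (j <ᵇ n))           ∎
    where open ≡-Reasoning

  decode-last-u : ∀ {p} → p < K → decodeSlot (X + 2 * (K ∸ suc p)) ≡ (p , n + n₀ , true)
  decode-last-u {p} p<K = begin
    decodeSlot (X + 2 * (K ∸ suc p))
      ≡⟨ decodeSlot-middle (m≤m+n X _) (+-monoʳ-< X (*-monoʳ-< 2 K∸1+p<K)) ⟩
    lastRowSlot ((X + 2 * (K ∸ suc p) ∸ X) % 2) ((X + 2 * (K ∸ suc p) ∸ X) / 2)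
      ≡⟨ cong₂ lastRowSlot
           (trans (cong (_% 2) (trans (m+n∸m≡n X _) (*-comm 2 (K ∸ suc p)))) (m*n%n≡0 (K ∸ suc p) 2))
           (trans (cong (_/ 2) (trans (m+n∸m≡n X _) (*-comm 2 (K ∸ suc p)))) (m*n/n≡m (K ∸ suc p) 2)) ⟩
    (K ∸ suc (K ∸ suc p) , n + n₀ , true)
      ≡⟨ cong (λ q → (q , n + n₀ , true)) (trans (cong (K ∸_) (sym (+-∸-assoc 1 p<K))) (m∸[m∸n]≡n (<⇒≤ p<K))) ⟩
    (p , n + n₀ , true)
      ∎
    where
    open ≡-Reasoning
    K∸1+p<K : K ∸ suc p < K
    K∸1+p<K = subst (_≤ K) (+-∸-assoc 1 p<K) (m∸n≤m K p)

  decode-last-v : ∀ {p} → p < K → decodeSlot (X + suc (2 * p)) ≡ (p , n + n₀ , false)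
  decode-last-v {p} p<K = begin
    decodeSlot (X + suc (2 * p))
      ≡⟨ decodeSlot-middle (m≤m+n X _) (+-monoʳ-< X (subst (_≤ 2 * K) (*-suc 2 p) (*-monoʳ-≤ 2 p<K))) ⟩
    lastRowSlot ((X + suc (2 * p) ∸ X) % 2) ((X + suc (2 * p) ∸ X) / 2)
      ≡⟨ cong₂ lastRowSlot (trans (cong (_% 2) (trans (m+n∸m≡n X _) (cong suc (*-comm 2 p)))) ([m+kn]%n≡m%n 1 p 2))
                           (trans (cong (_/ 2) (trans (m+n∸m≡n X _) (cong suc (*-comm 2 p))))
                                  (trans (+-distrib-/-∣ʳ 1 {d = 2} (divides-refl p)) (m*n/n≡m p 2))) ⟩
    (p , n + n₀ , false)
      ∎
    where open ≡-Reasoning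

  decode-slotLabel : ∀ {p j} s → p < K → j < N → decodeSlot (slotLabel p j s) ≡ (p , j , s)
  decode-slotLabel {p} {j} s p<K j<N with row j<N
  decode-slotLabel {p} {j} true  p<K j<N | lower j<n =
    trans (cong decodeSlot (slotLabel-lower true j<n))
          (trans (decode-low p<K (lower-ordinary j<n)) (cong (λ t → (p , j , t)) (<ᵇ-true j<n)))
  decode-slotLabel {p} {j} false p<K j<N | lower j<n =
    trans (cong decodeSlot (slotLabel-lower false j<n))
          (trans (decode-high p<K (lower-ordinary j<n)) (cong (λ t → (p , j , not t)) (<ᵇ-true j<n)))
  decode-slotLabel {p} {j} true  p<K j<N | upper n≤j sj<N =
    trans (cong decodeSlot (slotLabel-upper true n≤j sj<N))
          (trans (decode-high p<K sj<N) (cong (λ t → (p , j , not t)) (<ᵇ-false n≤j)))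
  decode-slotLabel {p} {j} false p<K j<N | upper n≤j sj<N =
    trans (cong decodeSlot (slotLabel-upper false n≤j sj<N))
          (trans (decode-low p<K sj<N) (cong (λ t → (p , j , t)) (<ᵇ-false n≤j)))
  decode-slotLabel {p} {j} true  p<K j<N | last refl = trans (cong decodeSlot slotLabel-last-u) (decode-last-u p<K)
  decode-slotLabel {p} {j} false p<K j<N | last refl = trans (cong decodeSlot slotLabel-last-v) (decode-last-v p<K)

  slotLabel-injective : ∀ {p j p′ j′} s s′ → p < K → j < N → p′ < K → j′ < N →
                        slotLabel p j s ≡ slotLabel p′ j′ s′ → (p , j , s) ≡ (p′ , j′ , s′)
  slotLabel-injective s s′ p<K j<N p′<K j′<N eq =
    trans (sym (decode-slotLabel s p<K j<N)) (trans (cong decodeSlot eq) (decode-slotLabel s′ p′<K j′<N))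

  rows-split : ∀ f → sumBelow N f ≡ sumBelow n f + (sumBelow n₀ (λ t → f (n + t)) + f (n + n₀))
  rows-split f = begin
    sumBelow N f                                                         ≡⟨ cong (λ t → sumBelow t f) N≡′ ⟩
    sumBelow (n + (n₀ + 1)) f                                            ≡⟨ sumBelow-+ n (n₀ + 1) f ⟩
    sumBelow n f + sumBelow (n₀ + 1) (λ t → f (n + t))                   ≡⟨ cong (sumBelow n f +_) (sumBelow-+ n₀ 1 _) ⟩
    sumBelow n f + (sumBelow n₀ (λ t → f (n + t)) + (f (n + (n₀ + 0)) + 0))
      ≡⟨ cong (λ x → sumBelow n f + (sumBelow n₀ (λ t → f (n + t)) + x))
              (trans (+-identityʳ _) (cong (λ t → f (n + t)) (+-identityʳ n₀))) ⟩
    sumBelow n f + (sumBelow n₀ (λ t → f (n + t)) + f (n + n₀))          ∎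
    where
    open ≡-Reasoning
    N≡′ : N ≡ n + (n₀ + 1)
    N≡′ = trans N≡ (trans (sym (+-suc n n₀)) (cong (n +_) (+-comm 1 n₀)))

  uRow : ℕ → ℕ → ℕ
  uRow p j = slotLabel p j true

  uRows : ℕ → ℕ
  uRows p = sumBelow N (uRow p)

  uRows+p : ∀ {p} → p < K → uRows p + p ≡ uRows 0
  uRows+p {p} p<K = begin
    uRows p + p
      ≡⟨ cong (_+ p) (rows-split (uRow p)) ⟩
    sumBelow n (uRow p) + (sumBelow n₀ (λ t → uRow p (n + t)) + uRow p (n + n₀)) + p
      ≡⟨ cong (λ L → L + (sumBelow n₀ (λ t → uRow p (n + t)) + uRow p (n + n₀)) + p) lower-rows ⟩
    sumBelow n (uRow 0) + n * p + (sumBelow n₀ (λ t → uRow p (n + t)) + uRow p (n + n₀)) + p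
      ≡⟨ regroup (sumBelow n (uRow 0)) (sumBelow n₀ (λ t → uRow p (n + t))) (uRow p (n + n₀)) n₀ p ⟩
    sumBelow n (uRow 0) + ((sumBelow n₀ (λ t → uRow p (n + t)) + n₀ * p) + (uRow p (n + n₀) + 2 * p))
      ≡⟨ cong₂ (λ M T → sumBelow n (uRow 0) + (M + T)) upper-rows last-row-u ⟩
    sumBelow n (uRow 0) + (sumBelow n₀ (λ t → uRow 0 (n + t)) + uRow 0 (n + n₀))
      ≡⟨ rows-split (uRow 0) ⟨
    uRows 0
      ∎
    where
    open ≡-Reasoning
    regroup : ∀ L M T n₀ p → L + suc n₀ * p + (M + T) + p ≡ L + ((M + n₀ * p) + (T + 2 * p))
    regroup = solve-∀
    lower-rows : sumBelow n (uRow p) ≡ sumBelow n (uRow 0) + n * p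
    lower-rows = trans (sumBelow-cong n (λ j j<n → trans (slotLabel-lower true j<n)
                                                          (cong (_+ p) (sym (trans (slotLabel-lower true j<n) (+-identityʳ _))))))
                       (trans (sumBelow-distrib n (uRow 0) (λ _ → p)) (cong (sumBelow n (uRow 0) +_) (sumBelow-const n p)))
    upper-rows : sumBelow n₀ (λ t → uRow p (n + t)) + n₀ * p ≡ sumBelow n₀ (λ t → uRow 0 (n + t))
    upper-rows = trans (cong (sumBelow n₀ (λ t → uRow p (n + t)) +_) (sym (sumBelow-const n₀ p)))
                       (trans (sym (sumBelow-distrib n₀ _ _)) (sumBelow-cong n₀ shift))
      where
      shift : ∀ t → t < n₀ → uRow p (n + t) + p ≡ uRow 0 (n + t)
      shift t t<n₀ = begin
        uRow p (n + t) + p             ≡⟨ cong (_+ p) (slotLabel-upper true n≤n+t ordinary) ⟩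
        Q ∸ suc (K * (n + t) + p) + p  ≡⟨ ∸-+-cancel Q (suc (K * (n + t))) p (low<Q p<K ordinary) ⟩
        Q ∸ suc (K * (n + t))          ≡⟨ cong (λ x → Q ∸ suc x) (+-identityʳ (K * (n + t))) ⟨
        high 0 (n + t)                 ≡⟨ slotLabel-upper true n≤n+t ordinary ⟨
        uRow 0 (n + t)                 ∎
        where
        n≤n+t : n ≤ n + t
        n≤n+t = m≤m+n n t
        ordinary : suc (n + t) < N
        ordinary = subst (suc (n + t) <_) (sym N≡) (s≤s (+-monoʳ-< n t<n₀))
    last-row-u : uRow p (n + n₀) + 2 * p ≡ uRow 0 (n + n₀)
    last-row-u = begin
      uRow p (n + n₀) + 2 * p          ≡⟨ cong (_+ 2 * p) slotLabel-last-u ⟩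
      X + 2 * (K ∸ suc p) + 2 * p      ≡⟨ +-assoc X _ _ ⟩
      X + (2 * (K ∸ suc p) + 2 * p)    ≡⟨ cong (X +_) (*-distribˡ-+ 2 (K ∸ suc p) p) ⟨
      X + 2 * (K ∸ suc p + p)          ≡⟨ cong (λ r → X + 2 * r) (∸-+-cancel K 1 p p<K) ⟩
      X + 2 * (K ∸ suc 0)              ≡⟨ slotLabel-last-u ⟨
      uRow 0 (n + n₀)                  ∎

  uRows0-bound : uRows 0 ≤ n * (K * n) + n * Q
  uRows0-bound = begin
    uRows 0                                                              ≡⟨ rows-split (uRow 0) ⟩
    sumBelow n (uRow 0) + (sumBelow n₀ (λ t → uRow 0 (n + t)) + uRow 0 (n + n₀))
      ≤⟨ +-mono-≤ lower-rows
           (+-mono-≤ (sumBelow-mono n₀ (λ t t<n₀ → <⇒≤ (slotLabel<Q true 0<K (row<N (<⇒≤ (+-monoʳ-< n t<n₀))))))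
                     (<⇒≤ (slotLabel<Q true 0<K (row<N ≤-refl)))) ⟩
    n * (K * n) + (sumBelow n₀ (λ _ → Q) + Q)                            ≡⟨ cong (λ x → n * (K * n) + (x + Q)) (sumBelow-const n₀ Q) ⟩
    n * (K * n) + (n₀ * Q + Q)                                           ≡⟨ cong (n * (K * n) +_) (+-comm (n₀ * Q) Q) ⟩
    n * (K * n) + n * Q                                                  ∎
    where
    open ≤-Reasoning
    0<K : 0 < K
    0<K = s≤s z≤n
    row<N : ∀ {j} → j ≤ n + n₀ → j < N
    row<N {j} j≤ = subst (j <_) (sym N≡) (s≤s j≤)
    lower-rows : sumBelow n (uRow 0) ≤ n * (K * n)
    lower-rows = ≤-trans (sumBelow-mono n (λ j j<n → ≤-trans (≤-reflexive (trans (slotLabel-lower true j<n) (+-identityʳ _)))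
                                                        (*-monoʳ-≤ K (<⇒≤ j<n))))
                    (≤-reflexive (sumBelow-const n (K * n)))

  vRows : ℕ → ℕ
  vRows p = sumBelow N (λ j → slotLabel p j false)

  rows-pair : ∀ {p} → p < K → uRows p + (N + vRows p) ≡ N * Q
  rows-pair {p} p<K = begin
    uRows p + (N + vRows p)
      ≡⟨ cong (uRows p +_) (sumBelow-suc N (λ j → slotLabel p j false)) ⟨
    uRows p + sumBelow N (λ j → suc (slotLabel p j false))
      ≡⟨ sumBelow-distrib N (uRow p) (λ j → suc (slotLabel p j false)) ⟨
    sumBelow N (λ j → slotLabel p j true + suc (slotLabel p j false))
      ≡⟨ sumBelow-cong N (λ j j<N → slotLabel-pair p<K j<N) ⟩
    sumBelow N (λ _ → Q)
      ≡⟨ sumBelow-const N Q ⟩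
    N * Q
      ∎
    where open ≡-Reasoning

  ySum uSum vTotal vSum : ℕ
  ySum = suc Q
  uSum = suc Q + N + uRows 0
  vTotal = Q + K + N * Q
  vSum = vTotal ∸ uRows 0

  u-sum : ∀ {p} → p < K → suc (Q + p) + (N + uRows p) ≡ uSum
  u-sum {p} p<K = trans (shuffle Q p N (uRows p)) (cong (suc Q + N +_) (trans (+-comm p (uRows p)) (uRows+p p<K)))
    where
    shuffle : ∀ Q p N U → suc (Q + p) + (N + U) ≡ suc Q + N + (p + U)
    shuffle = solve-∀

  v-sum : ∀ {q} → q < K → suc (Q + q) + (N + vRows (K ∸ suc q)) ≡ vSum
  v-sum {q} q<K = trans (sym (m+n∸n≡m _ (uRows 0))) (cong (_∸ uRows 0) (begin
    suc (Q + q) + (N + vRows p) + uRows 0             ≡⟨ cong (suc (Q + q) + (N + vRows p) +_) (uRows+p p<K) ⟨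
    suc (Q + q) + (N + vRows p) + (uRows p + p)       ≡⟨ shuffle Q q p N (vRows p) (uRows p) ⟩
    Q + (p + suc q) + (uRows p + (N + vRows p))       ≡⟨ cong₂ (λ a b → Q + a + b) (m∸n+n≡m q<K) (rows-pair p<K) ⟩
    Q + K + N * Q                                     ∎))
    where
    open ≡-Reasoning
    p : ℕ
    p = K ∸ suc q
    p<K : p < K
    p<K = subst (_≤ K) (+-∸-assoc 1 q<K) (m∸n≤m K q)
    shuffle : ∀ Q q p N V U → suc (Q + q) + (N + V) + (U + p) ≡ Q + (p + suc q) + (U + (N + V))
    shuffle = solve-∀

  ySum<uSum : ySum < uSum
  ySum<uSum = ≤-trans (m<m+n (suc Q) (s≤s z≤n)) (m≤m+n (suc Q + N) (uRows 0))

  uSum<2*vSum : uSum < 2 * vSum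
  uSum<2*vSum = begin-strict
    uSum                           ≡⟨ m+n∸n≡m uSum (2 * uRows 0) ⟨
    uSum + 2 * uRows 0 ∸ 2 * uRows 0 <⟨ ∸-monoˡ-< room (m≤n+m (2 * uRows 0) uSum) ⟩
    2 * vTotal ∸ 2 * uRows 0       ≡⟨ *-distribˡ-∸ 2 vTotal (uRows 0) ⟨
    2 * vSum                       ∎
    where
    open ≤-Reasoning
    room : uSum + 2 * uRows 0 < 2 * vTotal
    room = begin-strict
      uSum + 2 * uRows 0                          ≡⟨ three (suc Q + N) (uRows 0) ⟩
      suc Q + N + 3 * uRows 0                     ≤⟨ +-monoʳ-≤ (suc Q + N) (*-monoʳ-≤ 3 uRows0-bound) ⟩
      suc Q + N + 3 * (n * (K * n) + n * Q)       <⟨ s≤s (m≤m+n _ _) ⟩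
      suc (suc Q + N + 3 * (n * (K * n) + n * Q))
        + (2 * k₀ * n₀ * n₀ + 2 * n₀ * n₀ + 12 * k₀ * n₀ + 14 * k₀ + 10 * n₀ + 10)
                                                  ≡⟨ polynomial k₀ n₀ ⟩
      2 * vTotal                                  ∎
      where
      three : ∀ a U → a + U + 2 * U ≡ a + 3 * U
      three = solve-∀
      -- the difference of the two sides is a polynomial in k₀, n₀ with nonnegative coefficients
      polynomial : ∀ k₀ n₀ →
        let K = 2 * suc k₀ ; n = suc n₀ ; X = K * (n + n₀) ; Q = X + 2 * K + X in
        suc (suc Q + 2 * n + 3 * (n * (K * n) + n * Q))
          + (2 * k₀ * n₀ * n₀ + 2 * n₀ * n₀ + 12 * k₀ * n₀ + 14 * k₀ + 10 * n₀ + 10)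
        ≡ 2 * (Q + K + 2 * n * Q)
      polynomial = solve-∀

  labelOf : Fin K ⊎ Slot k n → ℕ
  labelOf (inj₁ q)           = Q + toℕ q
  labelOf (inj₂ (p , j , s)) = slotLabel (toℕ p) (toℕ j) s

  labelOf<K+Q : ∀ x → labelOf x < K + Q
  labelOf<K+Q (inj₁ q)           = subst (Q + toℕ q <_) (+-comm Q K) (+-monoʳ-< Q (FinP.toℕ<n q))
  labelOf<K+Q (inj₂ (p , j , s)) = <-≤-trans (slotLabel<Q s (FinP.toℕ<n p) (FinP.toℕ<n j)) (m≤n+m Q K)

  labelOf-injective : ∀ {x x′} → labelOf x ≡ labelOf x′ → x ≡ x′
  labelOf-injective {inj₁ q} {inj₁ q′} eq = cong inj₁ (FinP.toℕ-injective (+-cancelˡ-≡ Q _ _ eq))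
  labelOf-injective {inj₁ q} {inj₂ (p′ , j′ , s′)} eq =
    ⊥-elim (<⇒≱ (slotLabel<Q s′ (FinP.toℕ<n p′) (FinP.toℕ<n j′)) (≤-trans (m≤m+n Q (toℕ q)) (≤-reflexive eq)))
  labelOf-injective {inj₂ (p , j , s)} {inj₁ q′} eq =
    ⊥-elim (<⇒≱ (slotLabel<Q s (FinP.toℕ<n p) (FinP.toℕ<n j)) (≤-trans (m≤m+n Q (toℕ q′)) (≤-reflexive (sym eq))))
  labelOf-injective {inj₂ (p , j , s)} {inj₂ (p′ , j′ , s′)} eq
    with same ← slotLabel-injective s s′ (FinP.toℕ<n p) (FinP.toℕ<n j) (FinP.toℕ<n p′) (FinP.toℕ<n j′) eq
    with refl ← FinP.toℕ-injective (cong proj₁ same) | refl ← FinP.toℕ-injective (cong (proj₁ ∘ proj₂) same)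
       | refl ← cong (proj₂ ∘ proj₂) same = refl

  size≡ : length (edgesList k n) ≡ K + Q
  size≡ = trans (length-edgesList k n) (count k₀ n₀)
    where
    open EdgeList using (length-edgesList)
    count : ∀ k₀ n₀ → let k = suc k₀ ; n = suc n₀ ; K = 2 * k ; X = K * (n + n₀) in
            2 * k + 2 * k * (2 * n * 2) ≡ K + (X + 2 * K + X)
    count = solve-∀

  edgeLabel : EH k n → Fin (length (edgesList k n))
  edgeLabel e = F.fromℕ< (subst (labelOf (toSlot e) <_) (sym size≡) (labelOf<K+Q (toSlot e)))

  toℕ-edgeLabel : ∀ e → toℕ (edgeLabel e) ≡ labelOf (toSlot e)
  toℕ-edgeLabel e = FinP.toℕ-fromℕ< _

  edgeLabel-injective : Injective _≡_ _≡_ edgeLabel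
  edgeLabel-injective {e} {e′} eq =
    trans (sym (fromSlot-toSlot e)) (trans (cong fromSlot same-slot) (fromSlot-toSlot e′))
    where
    same-slot : toSlot e ≡ toSlot e′
    same-slot = labelOf-injective (trans (sym (toℕ-edgeLabel e)) (trans (cong toℕ eq) (toℕ-edgeLabel e′)))

  labelling : EH k n ⤖ Fin (length (edgesList k n))
  labelling = injection⇒bijection (subst (λ t → EH k n ↔ Fin t) (sym (EdgeList.length-edgesList k n)) edges↔Fin)
                                  edgeLabel edgeLabel-injective

module ConstructedLabelling (k₀ n₀ m : ℕ) (b : Fin (2 * suc k₀) → Fin m) where
  open Labelling k₀ n₀
  open EdgeView k n
  open QuotientGraph k n m b

  uSide vSide : Fin K → Fin N → ℕ
  uSide p j = suc (slotLabel (toℕ p) (toℕ j) true)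
  vSide p j = suc (slotLabel (toℕ p) (toℕ j) false)

  matching : Fin K → ℕ
  matching q = suc (Q + toℕ q)

  f : Graph.E G ⤖ Fin (size G)
  f = labelling

  label≡positional : ∀ e → label G f e ≡ positional uSide vSide matching e
  label≡positional (uv q)   = cong suc (toℕ-edgeLabel (uv q))
  label≡positional (uy i j) = cong suc (toℕ-edgeLabel (uy i j))
  label≡positional (vy i j) = cong suc (toℕ-edgeLabel (vy i j))
  label≡positional (vz i j) = cong suc (toℕ-edgeLabel (vz i j))
  label≡positional (uz i j) = cong suc (toℕ-edgeLabel (uz i j))

  vsum≡weightSum : ∀ x → vsum G f x ≡ weightSum G (positional uSide vSide matching) x
  vsum≡weightSum x = sum-map-cong (edgesList k n) (λ e → cong (λ l → if incident G x e then l else 0) (label≡positional e))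

  sum-y : ∀ i j → vsum G f (y i j) ≡ ySum
  sum-y i j = trans (vsum≡weightSum (y i j)) (trans (weightSum-y uSide vSide matching i j)
                    (cong suc (slotLabel-pair (FinP.toℕ<n (emb i)) (FinP.toℕ<n j))))

  sum-z : ∀ i j → vsum G f (z i j) ≡ ySum
  sum-z i j = trans (vsum≡weightSum (z i j)) (trans (weightSum-z uSide vSide matching i j)
                    (cong suc (slotLabel-pair (FinP.toℕ<n (rev i)) (FinP.toℕ<n j))))

  row-sum : ∀ s p → ∑[ j < N ] suc (slotLabel p (toℕ j) s) ≡ N + sumBelow N (λ j → slotLabel p j s)
  row-sum s p = trans (∑-toℕ N (λ j → suc (slotLabel p j s))) (sumBelow-suc N (λ j → slotLabel p j s))

  sum-u : ∀ p → vsum G f (u p) ≡ uSum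
  sum-u p = trans (vsum≡weightSum (u p)) (trans (weightSum-u uSide vSide matching p)
                  (trans (cong (matching p +_) (row-sum true (toℕ p))) (u-sum (FinP.toℕ<n p))))

  sum-v : ∀ q → matching q + ∑[ j < N ] vSide (opposite q) j ≡ vSum
  sum-v q = trans (cong (matching q +_) (trans (row-sum false (toℕ (opposite q)))
                                        (cong (λ p → N + vRows p) (FinP.opposite-prop q))))
                  (v-sum (FinP.toℕ<n q))

  sum-w : ∀ {s} → AllBlocksOfSize {k} s b → ∀ c → vsum G f (w c) ≡ vSum * s
  sum-w {s} blocks c = begin
    vsum G f (w c)
      ≡⟨ trans (vsum≡weightSum (w c)) (weightSum-w uSide vSide matching c) ⟩
    ∑[ q < K ] (if does (c F.≟ b q) then matching q + ∑[ j < N ] vSide (opposite q) j else 0)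
      ≡⟨ sum-cong-≗ {K} (λ q → in-block q) ⟩
    ∑[ q < K ] (if does (b q F.≟ c) then vSum else 0)
      ≡⟨ sum-allFin K _ ⟨
    sum (map (λ q → if does (b q F.≟ c) then vSum else 0) (allFin K))
      ≡⟨ sum-if-const (λ q → does (b q F.≟ c)) (λ _ → vSum) vSum (allFin K) (λ _ _ → refl) ⟩
    vSum * blockSize {k} b c
      ≡⟨ cong (vSum *_) (blocks c) ⟩
    vSum * s
      ∎
    where
    open ≡-Reasoning
    in-block : ∀ q → (if does (c F.≟ b q) then matching q + ∑[ j < N ] vSide (opposite q) j else 0)
                     ≡ (if does (b q F.≟ c) then vSum else 0)
    in-block q rewrite does-sym c (b q) | sum-v q = refl

  module _ {s} (2≤s : 2 ≤ s) (blocks : AllBlocksOfSize {k} s b) where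

    uSum<wSum : uSum < vSum * s
    uSum<wSum = <-≤-trans uSum<2*vSum (subst (_≤ vSum * s) (*-comm vSum 2) (*-monoʳ-≤ vSum 2≤s))

    three-sums : ∀ x → vsum G f x ≡ ySum ⊎ vsum G f x ≡ uSum ⊎ vsum G f x ≡ vSum * s
    three-sums (u p)   = inj₂ (inj₁ (sum-u p))
    three-sums (w c)   = inj₂ (inj₂ (sum-w blocks c))
    three-sums (y i j) = inj₁ (sum-y i j)
    three-sums (z i j) = inj₁ (sum-z i j)

    antimagic : IsLocalAntimagic G f
    antimagic (uv q)   eq = <⇒≢ uSum<wSum (trans (sym (sum-u q)) (trans eq (sum-w blocks (b q))))
    antimagic (uy i j) eq = <⇒≢ ySum<uSum (trans (sym (sum-y i j)) (trans (sym eq) (sum-u (emb i))))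
    antimagic (vy i j) eq = <⇒≢ (<-trans ySum<uSum uSum<wSum) (trans (sym (sum-y i j)) (trans (sym eq) (sum-w blocks (b (rev i)))))
    antimagic (vz i j) eq = <⇒≢ (<-trans ySum<uSum uSum<wSum) (trans (sym (sum-z i j)) (trans (sym eq) (sum-w blocks (b (emb i)))))
    antimagic (uz i j) eq = <⇒≢ ySum<uSum (trans (sym (sum-z i j)) (trans (sym eq) (sum-u (rev i))))

    three-colours : numColours G f ≡ 3
    three-colours = length-deduplicate≡3 ℕ._≟_ (map (vsum G f) (verticesG k n m))
      (<⇒≢ ySum<uSum) (<⇒≢ (<-trans ySum<uSum uSum<wSum)) (<⇒≢ uSum<wSum)
      (λ t∈ → let (x , _ , t≡) = ∈-map⁻ (vsum G f) {xs = verticesG k n m} t∈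
              in subst (λ t → t ≡ ySum ⊎ t ≡ uSum ⊎ t ≡ vSum * s) (sym t≡) (three-sums x))
      (attained (y zero zero) (sum-y zero zero)) (attained (u zero) (sum-u zero)) (attained (w (b zero)) (sum-w blocks (b zero)))
      where
      attained : ∀ x {t} → vsum G f x ≡ t → t ∈ map (vsum G f) (verticesG k n m)
      attained x refl = ∈-map⁺ (vsum G f) (vertices-complete x)

  at-least-three : BalancedBipartite G ⊎ ChromaticNumber3 G →
                   (f′ : Graph.E G ⤖ Fin (size G)) → IsLocalAntimagic G f′ → 3 ≤ numColours G f′
  at-least-three hyp f′ antimagic′ = ≮⇒≥ λ fewer →
    let (a , b′ , two) = length-deduplicate≤2 ℕ._≟_ (map (vsum G f′) (verticesG k n m))
                           (∈-map⁺ (vsum G f′) (vertices-complete (u zero))) (≤-pred fewer)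
        open TwoSums G f′ antimagic′ a b′ (λ x → two (∈-map⁺ (vsum G f′) (vertices-complete x)))
    in [ twoSums⇒¬balancedBipartite vertices-complete edges-complete vertices-once (uv zero)
       , twoSums⇒¬chromaticNumber3 ]′ hyp

theorem2p12 : (k s n m : ℕ) → 2 ≤ k → 2 ≤ s → 1 ≤ n →
    (b : Fin (2 * k) → Fin m) → AllBlocksOfSize {k} s b → NoCommonNeighbour {k} n b →
    BalancedBipartite (Gquot k n m b) ⊎ ChromaticNumber3 (Gquot k n m b) →
    LocalAntimagicChromatic≡ (Gquot k n m b) 3
theorem2p12 (suc k₀) s (suc n₀) m _ 2≤s _ b blocks _ hyp =
  (f , antimagic 2≤s blocks , three-colours 2≤s blocks) , at-least-three hyp
  where open ConstructedLabelling k₀ n₀ m b
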